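{- Let $k\geq 2$. The formal power series $T_k(x_1,\ldots,x_r)$, $r\geq 1$, satisfy $T_k(x_1)=T_k(x_1,x_2)=\cdots=T_k(x_1,\ldots,x_{k-1})=x_1$, and for $r\geq k$, $$T_k(x_1,x_2,\ldots,x_r)=T_k\!\left(x_1,x_2,\ldots,x_{r-k},\frac{x_{r-k+1}}{1-x_{r-k+1}x_{r-k+2}\cdots x_r},x_{r-k+2},\ldots,x_{r-1}\right),$$ where the right-hand side is the $(r-1)$-variable series $T_k$ with the indicated substitution for its $(r-k+1)$st variable.
   Context: Let $k\geq 2$, $n\geq 0$. An augmented $k$-Catalan path of order $n$ is a lattice path $(0,z_0),(1,z_1),\ldots,(kn+1,z_{kn+1})$ with $z_0=0$, each step being an up step $(1,1)$ or a down step $(1,1-k)$, with $(k-1)n+1$ up steps and $n$ down steps, whose first step is an up step, and with $z_i\geq 1$ for all $1\leq i\leq kn+1$. The level of the lattice point $(i,z_i)$ is $z_i$. For a vector $\overline{\imath}=(i_1,\ldots,i_r)$ of nonnegative integers with $i_1\geq1$, an augmented $k$-Catalan path (of any order) has type $\overline{\imath}$ if for each $j\in\{1,\ldots,r\}$ exactly $i_j$ of its lattice points $(1,z_1),\ldots,(kn+1,z_{kn+1})$ lie at level $j$ and none lies at a level greater than $r$. Let $t_k(\overline{\imath})$ be the number of augmented $k$-Catalan paths of type $\overline{\imath}$ and $T_k(x_1,\ldots,x_r)=\sum_{\overline{\imath}\in\mathbb{P}\times\mathbb{N}^{r-1}}t_k(\overline{\imath})x_1^{i_1}\cdots x_r^{i_r}$,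 with $\mathbb{P}$ the positive and $\mathbb{N}$ the nonnegative integers. -}

module Defs where

open import Data.Nat using (ℕ; zero; suc; _+_; _*_; _∸_; _≤ᵇ_; _≡ᵇ_)
open import Data.Bool using (Bool; true; false; _∧_; if_then_else_)
open import Data.List as L using (List; []; _∷_; map; length; concatMap; upTo; filterᵇ)
open import Data.Nat.ListAction using (sum)
open import Data.Bool.ListAction using (all; any)
open import Data.Vec as V using (Vec; []; _∷_; tabulate; zipWith; replicate)
open import Data.Fin using (Fin; toℕ)
open import Data.Integer as Z using (ℤ; +_)
open import Relation.Binary.PropositionalEquality using (_≡_)

-- Formal power series in r variables x₁,…,x_r with ℕ coefficients.
-- A monomial x₁^{i₁}⋯x_r^{i_r} is its exponent vector (i₁,…,i_r);
-- a series is its coefficient function.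

Mon : ℕ → Set
Mon r = Vec ℕ r

FPS : ℕ → Set
FPS r = Mon r → ℕ

_≈_ : ∀ {r} → FPS r → FPS r → Set
f ≈ g = ∀ i → f i ≡ g i

range : ℕ → List ℕ
range n = upTo (suc n)

below : ∀ {r} → Vec ℕ r → List (Vec ℕ r)
below [] = [] ∷ []
below (i ∷ is) = concatMap (λ a → map (a ∷_) (below is)) (range i)

box : (m d : ℕ) → List (Vec ℕ m)
box zero d = [] ∷ []
box (suc m) d = concatMap (λ a → map (a ∷_) (box m d)) (range d)

deg : ∀ {r} → Vec ℕ r → ℕ
deg = V.sum

vecEq : ∀ {r} → Vec ℕ r → Vec ℕ r → Bool
vecEq [] [] = true
vecEq (a ∷ as) (b ∷ bs) = (a ≡ᵇ b) ∧ vecEq as bs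

mono : ∀ {r} → Vec ℕ r → FPS r
mono e i = if vecEq e i then 1 else 0

oneₛ : ∀ {r} → FPS r
oneₛ = mono (replicate _ 0)

_*ₛ_ : ∀ {r} → FPS r → FPS r → FPS r
(f *ₛ g) i = sum (map (λ a → f a * g (zipWith _∸_ i a)) (below i))

_^ₛ_ : ∀ {r} → FPS r → ℕ → FPS r
f ^ₛ zero = oneₛ
f ^ₛ suc n = f *ₛ (f ^ₛ n)

prodPow : ∀ {r m} → Vec (FPS r) m → Vec ℕ m → FPS r
prodPow [] [] = oneₛ
prodPow (g ∷ gs) (a ∷ as) = (g ^ₛ a) *ₛ prodPow gs as

-- Substitution F(g₁,…,g_m) = Σ_a F_a g₁^{a₁}⋯g_m^{a_m}, for series gⱼ with
-- zero constant term.  Then g^a has only monomials of total degree ≥ |a|,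
-- so the coefficient at i only receives contributions from a with
-- |a| ≤ deg i, all of which lie in box m (deg i): the finite sum is exact.
compose : ∀ {m r} → FPS m → Vec (FPS r) m → FPS r
compose {m} F gs i = sum (map (λ a → F a * prodPow gs a i) (box m (deg i)))

-- the variable x_{j+1} (0-based index j) in r variables
unitVec : (r j : ℕ) → Vec ℕ r
unitVec r j = tabulate (λ l → if toℕ l ≡ᵇ j then 1 else 0)

var : (r j : ℕ) → FPS r
var r j = mono (unitVec r j)

-- univariate geometric series 1/(1-y) = Σ y^n
geom : FPS 1
geom _ = 1

-- 1/(1-h) for h with zero constant term
inv1m : ∀ {r} → FPS r → FPS r
inv1m h = compose geom (h ∷ [])

-- Augmented k-Catalan paths.  A path is its list of steps:
-- true = up step (1,1), false = down step (1,1-k).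

stepZ : ℕ → Bool → ℤ → ℤ
stepZ k true z = z Z.+ + 1
stepZ k false z = z Z.+ (+ 1 Z.- + k)

-- levels z₁,…,z_N of the lattice points after each step, starting at z₀
levels : ℕ → ℤ → List Bool → List ℤ
levels k z [] = []
levels k z (s ∷ ss) = stepZ k s z ∷ levels k (stepZ k s z) ss

countᵇ : {A : Set} → (A → Bool) → List A → ℕ
countᵇ p xs = length (filterᵇ p xs)

notᵇ : Bool → Bool
notᵇ true = false
notᵇ false = true

firstUp : List Bool → Bool
firstUp [] = false
firstUp (s ∷ _) = s

isAugmented : ℕ → ℕ → List Bool → Bool
isAugmented k n ss =
  (length ss ≡ᵇ k * n + 1)
  ∧ (countᵇ (λ s → s) ss ≡ᵇ (k ∸ 1) * n + 1)
  ∧ (countᵇ notᵇ ss ≡ᵇ n)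
  ∧ firstUp ss
  ∧ all (λ z → + 1 Z.≤ᵇ z) (levels k (+ 0) ss)

intEq : ℤ → ℤ → Bool
intEq a b = (a Z.≤ᵇ b) ∧ (b Z.≤ᵇ a)

vecAllᵇ : ∀ {r} → (Fin r → ℕ → Bool) → Vec ℕ r → Bool
vecAllᵇ {zero} p [] = true
vecAllᵇ {suc r} p (i ∷ is) = p Fin.zero i ∧ vecAllᵇ (λ j → p (Fin.suc j)) is
  where import Data.Fin as Fin

hasType : ∀ {r} → ℕ → Vec ℕ r → List Bool → Bool
hasType {r} k is ss =
  vecAllᵇ (λ j ij → countᵇ (intEq (+ suc (toℕ j))) (levels k (+ 0) ss) ≡ᵇ ij) is
  ∧ all (λ z → z Z.≤ᵇ + r) (levels k (+ 0) ss)

allPaths : ℕ → List (List Bool)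
allPaths zero = [] ∷ []
allPaths (suc N) = concatMap (λ ss → (true ∷ ss) ∷ (false ∷ ss) ∷ []) (allPaths N)

-- A path of type i has exactly deg i lattice points (1,z₁),…,(N,z_N), so
-- N = deg i steps, and its order n satisfies kn+1 = N, hence n ≤ N.
t : ∀ {r} → ℕ → Vec ℕ r → ℕ
t k is = countᵇ (λ ss → any (λ n → isAugmented k n ss) (range (deg is)) ∧ hasType k is ss)
                (allPaths (deg is))

-- T_k(x₁,…,x_r) = Σ_{i ∈ ℙ × ℕ^{r-1}} t_k(i) x^i   (r ≥ 1; r = 0 unused)
T : ℕ → (r : ℕ) → FPS r
T k zero _ = 0
T k (suc r) (i₁ ∷ is) = if 1 ≤ᵇ i₁ then t k (i₁ ∷ is) else 0

-- the substitution vector for the recursion (r ≥ k): variable l (0-based)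
-- of T_k(·) in r-1 variables becomes x_{l+1}, except l = r-k (the (r-k+1)st)
-- which becomes x_{r-k+1} / (1 - x_{r-k+1} x_{r-k+2} ⋯ x_r).
tailBlock : (r p : ℕ) → Vec ℕ r
tailBlock r p = tabulate (λ l → if p ≤ᵇ toℕ l then 1 else 0)

substVec : (k r : ℕ) → Vec (FPS r) (r ∸ 1)
substVec k r = tabulate (λ l →
  if toℕ l ≡ᵇ r ∸ k
  then var r (r ∸ k) *ₛ inv1m (mono (tailBlock r (r ∸ k)))
  else var r (toℕ l))

module Submission where

-- An augmented path of type i is a
-- walk from level 0 which visits each level j exactly i_j times, ends at level 1
-- and never leaves [1, r]; such walks are counted by recursion on the first step.
--
-- For r < k no down step is possible, so the only path is the single up step.
-- For r ≥ k put p = r − k + 1.  The top level r can only be entered by an up step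
-- from r − 1 and is left by a down step to p, so every visit to r is part of a
-- loop p → p+1 → ⋯ → r → p.  If c = i_r, then either some level in [p, r − 1] is
-- visited fewer than c times and there is no walk at all, or deleting the c loops
-- gives a walk of type a on r − 1 levels, where a is i with c removed at the levels
-- p, …, r − 1; conversely the c loops can be reinserted after the a_p visits to p
-- in (a_p multichoose c) ways.  On the series side the a_p-th power of
-- x_p / (1 − x_p ⋯ x_r) is Σ_c (a_p multichoose c) x_p^{a_p} (x_p ⋯ x_r)^c, so the
-- coefficient of x^i in the substituted series is the same product.

open import Defs
open import Data.Nat using (ℕ; zero; suc; _+_; _*_; _∸_; _≤ᵇ_; _<ᵇ_; _≡ᵇ_; _≤_; _<_; z≤n; s≤s; _≤?_; _≟_; _<?_)
open import Data.Nat.Properties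
open import Data.Nat.ListAction using (sum)
open import Data.Nat.ListAction.Properties using (sum-++)
open import Data.Nat.Solver using (module +-*-Solver)
open import Data.Bool using (Bool; true; false; _∧_; if_then_else_) renaming (T to Tb)
open import Data.Bool.ListAction using (all; any)
open import Data.Bool.Properties using (∧-identityʳ; ∧-zeroʳ)
open import Data.List using (List; []; _∷_; _++_; map; length; concatMap; applyUpTo)
import Data.List.Properties as LP
open import Data.Vec as Vec using (Vec; []; _∷_; zipWith; replicate; tabulate; lookup)
import Data.Vec.Properties as VP
open import Data.Fin as Fin using (Fin; toℕ; fromℕ<)
open import Data.Fin.Properties using (toℕ<n; toℕ-fromℕ<)
open import Data.Integer as Z using (ℤ; _⊖_)
open import Data.Integer.Properties using (⊖-≥; [1+m]⊖[1+n]≡m⊖n)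
open import Data.Product using (_×_; _,_; Σ)
open import Data.Sum using (_⊎_; inj₁; inj₂)
open import Data.Unit using (⊤; tt)
open import Data.Empty using (⊥-elim; ⊥)
open import Function using (case_of_)
open import Relation.Binary.PropositionalEquality
open import Relation.Nullary using (Dec; yes; no; ¬_)
open ≡-Reasoning
open +-*-Solver using (solve; _:+_; _:*_; _:=_; con)

guard : Bool → ℕ → ℕ
guard true x = x
guard false _ = 0

guard-0 : ∀ b → guard b 0 ≡ 0
guard-0 true = refl
guard-0 false = refl

guard-≡0 : ∀ b x → (b ≡ true → x ≡ 0) → guard b x ≡ 0
guard-≡0 true x f = f refl
guard-≡0 false x f = refl

guard-t : ∀ {b} x → b ≡ true → guard b x ≡ x
guard-t x refl = refl

guard-f : ∀ {b} x → b ≡ false → guard b x ≡ 0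
guard-f x refl = refl

guard-cong : ∀ b {x y} → (b ≡ true → x ≡ y) → guard b x ≡ guard b y
guard-cong true f = f refl
guard-cong false f = refl

guard-∧ : ∀ a b x → guard a (guard b x) ≡ guard (a ∧ b) x
guard-∧ true b x = refl
guard-∧ false b x = refl

guard-∧t : ∀ {b} c x → b ≡ true → guard (b ∧ c) x ≡ guard c x
guard-∧t c x refl = refl

guard-∧f : ∀ {b} c x → b ≡ false → guard (b ∧ c) x ≡ 0
guard-∧f c x refl = refl

guard-comm : ∀ a b x → guard a (guard b x) ≡ guard b (guard a x)
guard-comm true b x = refl
guard-comm false true x = refl
guard-comm false false x = refl

guard-+ : ∀ b x y → guard b (x + y) ≡ guard b x + guard b y
guard-+ true x y = refl
guard-+ false x y = refl

guard-* : ∀ b x y → guard b x * y ≡ guard b (x * y)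
guard-* true x y = refl
guard-* false x y = refl

*-guard : ∀ n b x → n * guard b x ≡ guard b (n * x)
*-guard n true x = refl
*-guard n false x = *-zeroʳ n

if-t : ∀ {A : Set} {b} (x y : A) → b ≡ true → (if b then x else y) ≡ x
if-t x y refl = refl

if-f : ∀ {A : Set} {b} (x y : A) → b ≡ false → (if b then x else y) ≡ y
if-f x y refl = refl

∧-elimˡ : ∀ {a b} → a ∧ b ≡ true → a ≡ true
∧-elimˡ {true} _ = refl

∧-elimʳ : ∀ {a b} → a ∧ b ≡ true → b ≡ true
∧-elimʳ {true} e = e

∧-intro : ∀ {a b} → a ≡ true → b ≡ true → a ∧ b ≡ true
∧-intro refl refl = refl

∧-shuffle : ∀ a b c d → ((a ∧ b) ∧ (c ∧ d)) ≡ ((a ∧ c) ∧ (b ∧ d))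
∧-shuffle true true c d = refl
∧-shuffle true false true d = refl
∧-shuffle true false false d = refl
∧-shuffle false b c d = refl

true⇔true⇒≡ : ∀ {a b} → (a ≡ true → b ≡ true) → (b ≡ true → a ≡ true) → a ≡ b
true⇔true⇒≡ {true} {b} f g = sym (f refl)
true⇔true⇒≡ {false} {true} f g with g refl
... | ()
true⇔true⇒≡ {false} {false} f g = refl

T⇒≡true : ∀ {b} → Tb b → b ≡ true
T⇒≡true {true} _ = refl

≡true⇒T : ∀ {b} → b ≡ true → Tb b
≡true⇒T refl = tt

≤ᵇ≡true : ∀ {m n} → m ≤ n → (m ≤ᵇ n) ≡ true
≤ᵇ≡true p = T⇒≡true (≤⇒≤ᵇ p)

≤ᵇ≡true⇒≤ : ∀ {m n} → (m ≤ᵇ n) ≡ true → m ≤ n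
≤ᵇ≡true⇒≤ {m} {n} e = ≤ᵇ⇒≤ m n (≡true⇒T e)

≡ᵇ≡true : ∀ {m n} → m ≡ n → (m ≡ᵇ n) ≡ true
≡ᵇ≡true {m} {n} p = T⇒≡true (≡⇒≡ᵇ m n p)

≡ᵇ≡true⇒≡ : ∀ {m n} → (m ≡ᵇ n) ≡ true → m ≡ n
≡ᵇ≡true⇒≡ {m} {n} e = ≡ᵇ⇒≡ m n (≡true⇒T e)

≡ᵇ≡false : ∀ {m n} → ¬ m ≡ n → (m ≡ᵇ n) ≡ false
≡ᵇ≡false {m} {n} ne with m ≡ᵇ n in eq
... | true = ⊥-elim (ne (≡ᵇ≡true⇒≡ eq))
... | false = refl

≤ᵇ≡false : ∀ {m n} → ¬ m ≤ n → (m ≤ᵇ n) ≡ false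
≤ᵇ≡false {m} {n} ne with m ≤ᵇ n in eq
... | true = ⊥-elim (ne (≤ᵇ≡true⇒≤ eq))
... | false = refl

<ᵇ≡false : ∀ {m n} → ¬ m < n → (m <ᵇ n) ≡ false
<ᵇ≡false {m} {n} ne with m <ᵇ n in eq
... | true = ⊥-elim (ne (<ᵇ⇒< m n (≡true⇒T eq)))
... | false = refl

<ᵇ≡true : ∀ {m n} → m < n → (m <ᵇ n) ≡ true
<ᵇ≡true lt = T⇒≡true (<⇒<ᵇ lt)

<ᵇ-suc : ∀ e0 x → (e0 <ᵇ suc x) ≡ (e0 ≤ᵇ x)
<ᵇ-suc zero x = refl
<ᵇ-suc (suc e0) x = refl

suc<ᵇ : ∀ y j → ¬ j ≡ suc y → (suc y <ᵇ j) ≡ (y <ᵇ j)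
suc<ᵇ y j ne with y <? j
... | yes yj = trans (<ᵇ≡true (≤∧≢⇒< yj (λ x → ne (sym x)))) (sym (<ᵇ≡true yj))
... | no nyj = trans (<ᵇ≡false (λ x → nyj (<-trans (n<1+n y) x))) (sym (<ᵇ≡false nyj))

≤ᵇ∧≡ᵇ∸≡≡ᵇ+ : ∀ e e' x → ((e ≤ᵇ x) ∧ (e' ≡ᵇ x ∸ e)) ≡ (e + e' ≡ᵇ x)
≤ᵇ∧≡ᵇ∸≡≡ᵇ+ e e' x = true⇔true⇒≡ to from
  where
  to : ((e ≤ᵇ x) ∧ (e' ≡ᵇ x ∸ e)) ≡ true → (e + e' ≡ᵇ x) ≡ true
  to h = ≡ᵇ≡true (trans (cong (e +_) (≡ᵇ≡true⇒≡ (∧-elimʳ {e ≤ᵇ x} h))) (m+[n∸m]≡n (≤ᵇ≡true⇒≤ {e} {x} (∧-elimˡ h))))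
  from : (e + e' ≡ᵇ x) ≡ true → ((e ≤ᵇ x) ∧ (e' ≡ᵇ x ∸ e)) ≡ true
  from h = let ee = ≡ᵇ≡true⇒≡ h in ∧-intro (≤ᵇ≡true (subst (e ≤_) ee (m≤m+n e e'))) (≡ᵇ≡true (sym (trans (cong (_∸ e) (sym ee)) (m+n∸m≡n e e'))))

subst-< : ∀ {a b a' b'} → a' ≡ a → b' ≡ b → a < b → a' < b'
subst-< refl refl h = h

suc[m∸1]≡m : ∀ {m} → 1 ≤ m → suc (m ∸ 1) ≡ m
suc[m∸1]≡m {suc m} _ = refl

≤-pred-≢ : ∀ {l z} → l ≤ suc z → ¬ l ≡ suc z → l ≤ z
≤-pred-≢ a b = ≤-pred (≤∧≢⇒< a b)

1≤∸ : ∀ k' z → suc (suc k') ≤ z → 1 ≤ z ∸ suc k'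
1≤∸ k' z p = subst (_≤ z ∸ suc k') (m+n∸n≡m 1 (suc k')) (∸-monoˡ-≤ (suc k') p)

m+1<n⇒m<n∸1 : ∀ x y → x + 1 < y → x < y ∸ 1
m+1<n⇒m<n∸1 x (suc y) (s≤s h) rewrite +-comm x 1 = h

m<n⇒m<n∸1+1 : ∀ x y → x < y → x < (y ∸ 1) + 1
m<n⇒m<n∸1+1 x (suc y) h rewrite +-comm y 1 = h

m+d<n⇒m∸1+[d+1]<n : ∀ x d y → 1 ≤ x → x + d < y → (x ∸ 1) + (d + 1) < y
m+d<n⇒m∸1+[d+1]<n (suc x) d y _ h rewrite +-comm d 1 | +-suc x d = h

sum-concatMap : {A B : Set} (h : B → ℕ) (f : A → List B) (xs : List A) →
  sum (map h (concatMap f xs)) ≡ sum (map (λ x → sum (map h (f x))) xs)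
sum-concatMap h f [] = refl
sum-concatMap h f (x ∷ xs) = trans (cong sum (LP.map-++ h (f x) (concatMap f xs)))
  (trans (sum-++ (map h (f x)) _) (cong (sum (map h (f x)) +_) (sum-concatMap h f xs)))

sum-map-map : {A B : Set} (h : B → ℕ) (g : A → B) (xs : List A) → sum (map h (map g xs)) ≡ sum (map (λ x → h (g x)) xs)
sum-map-map h g xs = cong sum (sym (LP.map-∘ xs))

sum-cong : {A : Set} {f g : A → ℕ} → (∀ a → f a ≡ g a) → (xs : List A) → sum (map f xs) ≡ sum (map g xs)
sum-cong e xs = cong sum (LP.map-cong e xs)

sum-zero : {A : Set} (f : A → ℕ) → (∀ a → f a ≡ 0) → (xs : List A) → sum (map f xs) ≡ 0
sum-zero f e [] = refl
sum-zero f e (x ∷ xs) rewrite e x = sum-zero f e xs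

sum-guard : {A : Set} (b : Bool) (F : A → ℕ) (xs : List A) → sum (map (λ a → guard b (F a)) xs) ≡ guard b (sum (map F xs))
sum-guard true F xs = refl
sum-guard false F xs = sum-zero _ (λ _ → refl) xs

sumBelow : ℕ → (ℕ → ℕ) → ℕ
sumBelow zero g = 0
sumBelow (suc n) g = g 0 + sumBelow n (λ x → g (suc x))

sum-applyUpTo : (h : ℕ → ℕ) (f : ℕ → ℕ) (n : ℕ) → sum (map h (applyUpTo f n)) ≡ sumBelow n (λ x → h (f x))
sum-applyUpTo h f zero = refl
sum-applyUpTo h f (suc n) = cong (h (f 0) +_) (sum-applyUpTo h (λ x → f (suc x)) n)

sum-range : (h : ℕ → ℕ) (n : ℕ) → sum (map h (range n)) ≡ sumBelow (suc n) h
sum-range h n = sum-applyUpTo h (λ x → x) (suc n)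

sumBelow-cong : ∀ n {f g : ℕ → ℕ} → (∀ x → x < n → f x ≡ g x) → sumBelow n f ≡ sumBelow n g
sumBelow-cong zero e = refl
sumBelow-cong (suc n) e = cong₂ _+_ (e 0 (s≤s z≤n)) (sumBelow-cong n (λ x lt → e (suc x) (s≤s lt)))

sumBelow-zero : ∀ n (f : ℕ → ℕ) → (∀ x → x < n → f x ≡ 0) → sumBelow n f ≡ 0
sumBelow-zero zero f e = refl
sumBelow-zero (suc n) f e rewrite e 0 (s≤s z≤n) = sumBelow-zero n (λ x → f (suc x)) (λ x lt → e (suc x) (s≤s lt))

sumBelow-single : ∀ n (f : ℕ → ℕ) x0 → (∀ x → x < n → ¬ x ≡ x0 → f x ≡ 0) → sumBelow n f ≡ guard (x0 <ᵇ n) (f x0)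
sumBelow-single zero f x0 e = refl
sumBelow-single (suc n) f zero e = trans (cong (f 0 +_) (sumBelow-zero n _ (λ x lt → e (suc x) (s≤s lt) (λ ())))) (+-identityʳ _)
sumBelow-single (suc n) f (suc x0) e = trans (cong (_+ sumBelow n (λ x → f (suc x))) (e 0 (s≤s z≤n) (λ ()))) (sumBelow-single n (λ x → f (suc x)) x0 (λ x lt ne → e (suc x) (s≤s lt) (λ eq → ne (suc-injective eq))))

sumBelow-trunc : ∀ m n (g : ℕ → ℕ) → (∀ x → m ≤ x → g x ≡ 0) → m ≤ n → sumBelow n g ≡ sumBelow m g
sumBelow-trunc zero n g h _ = sumBelow-zero n g (λ x _ → h x z≤n)
sumBelow-trunc (suc m) (suc n) g h (s≤s le) = cong (g 0 +_) (sumBelow-trunc m n (λ x → g (suc x)) (λ x a → h (suc x) (s≤s a)) le)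

sum-range-at : ∀ x e0 (Y : ℕ → ℕ) → sum (map (λ a → guard (e0 ≡ᵇ a) (Y a)) (range x)) ≡ guard (e0 ≤ᵇ x) (Y e0)
sum-range-at x e0 Y = trans (sum-range _ x) (trans (sumBelow-single (suc x) _ e0 (λ a _ ne → cong (λ b → guard b (Y a)) (≡ᵇ≡false (λ e → ne (sym e)))))
  (cong₂ guard (<ᵇ-suc e0 x) (cong (λ b → guard b (Y e0)) (≡ᵇ≡true (refl {x = e0})))))

sum-range-at-∸ : ∀ x e0 (Y : ℕ → ℕ) → sum (map (λ a → guard (e0 ≡ᵇ x ∸ a) (Y a)) (range x)) ≡ guard (e0 ≤ᵇ x) (Y (x ∸ e0))
sum-range-at-∸ x e0 Y with e0 ≤? x
... | yes ex = trans (sum-range _ x) (trans (sumBelow-single (suc x) (λ a → guard (e0 ≡ᵇ x ∸ a) (Y a)) (x ∸ e0)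
        (λ a lt ne → cong (λ b → guard b (Y a)) (≡ᵇ≡false {e0} {x ∸ a} (λ e → ne (sym (trans (cong (x ∸_) e) (m∸[m∸n]≡n (≤-pred lt))))))))
        (trans (guard-t _ (T⇒≡true (<⇒<ᵇ (s≤s (m∸n≤m x e0))))) (trans (guard-t _ (≡ᵇ≡true (sym (m∸[m∸n]≡n ex)))) (sym (guard-t _ (≤ᵇ≡true ex))))))
... | no nex = trans (sum-range _ x) (trans (sumBelow-zero (suc x) (λ a → guard (e0 ≡ᵇ x ∸ a) (Y a)) (λ a lt → guard-f (Y a) (≡ᵇ≡false (λ e → nex (subst (_≤ x) (sym e) (m∸n≤m x a))))))
        (sym (guard-f (Y (x ∸ e0)) (≤ᵇ≡false nex))))

AllBounded : ∀ {m} → ℕ → Vec ℕ m → Set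
AllBounded d [] = ⊤
AllBounded d (x ∷ xs) = (x ≤ d) × AllBounded d xs

sum-box-single : ∀ m d (a0 : Vec ℕ m) (h : Vec ℕ m → ℕ) → AllBounded d a0 → (∀ a → ¬ a ≡ a0 → h a ≡ 0) → sum (map h (box m d)) ≡ h a0
sum-box-single zero d [] h _ _ = +-identityʳ _
sum-box-single (suc m) d (x0 ∷ a0) h (x0d , al) hz =
  begin
    sum (map h (box (suc m) d))
      ≡⟨ sum-concatMap h (λ a → map (a ∷_) (box m d)) (range d) ⟩
    sum (map (λ a → sum (map h (map (a ∷_) (box m d)))) (range d))
      ≡⟨ sum-cong (λ a → sum-map-map h (a ∷_) (box m d)) (range d) ⟩
    sum (map (λ a → sum (map (λ as → h (a ∷ as)) (box m d))) (range d))
      ≡⟨ sum-range _ d ⟩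
    sumBelow (suc d) (λ a → sum (map (λ as → h (a ∷ as)) (box m d)))
      ≡⟨ sumBelow-single (suc d) _ x0 (λ a _ ne → sum-zero _ (λ as → hz (a ∷ as) (λ e → ne (VP.∷-injectiveˡ e))) (box m d)) ⟩
    guard (x0 <ᵇ suc d) (sum (map (λ as → h (x0 ∷ as)) (box m d)))
      ≡⟨ guard-t _ (T⇒≡true (<⇒<ᵇ (s≤s x0d))) ⟩
    sum (map (λ as → h (x0 ∷ as)) (box m d))
      ≡⟨ sum-box-single m d a0 (λ as → h (x0 ∷ as)) al (λ as ne → hz (x0 ∷ as) (λ e → ne (VP.∷-injectiveʳ e))) ⟩
    h (x0 ∷ a0)
  ∎

any-elim : {A : Set} (p : A → Bool) (xs : List A) → any p xs ≡ true → Σ A (λ x → p x ≡ true)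
any-elim p (x ∷ xs) e with p x in eq
... | true = x , eq
... | false = any-elim p xs e

any-applyUpTo : (p : ℕ → Bool) (g : ℕ → ℕ) (N n : ℕ) → n < N → p (g n) ≡ true → any p (applyUpTo g N) ≡ true
any-applyUpTo p g (suc N) zero _ e rewrite e = refl
any-applyUpTo p g (suc N) (suc n) (s≤s lt) e with p (g 0)
... | true = refl
... | false = any-applyUpTo p (λ x → g (suc x)) N n lt e

vecEq-true : ∀ {n} (a b : Vec ℕ n) → vecEq a b ≡ true → a ≡ b
vecEq-true [] [] e = refl
vecEq-true (x ∷ a) (y ∷ b) e = cong₂ _∷_ (≡ᵇ≡true⇒≡ (∧-elimˡ e)) (vecEq-true a b (∧-elimʳ {x ≡ᵇ y} e))

vecEq-refl : ∀ {n} (a : Vec ℕ n) → vecEq a a ≡ true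
vecEq-refl [] = refl
vecEq-refl (x ∷ a) = ∧-intro (≡ᵇ≡true (refl {x = x})) (vecEq-refl a)

vecEq-false : ∀ {n} (a b : Vec ℕ n) → ¬ a ≡ b → vecEq a b ≡ false
vecEq-false a b ne with vecEq a b in eq
... | true = ⊥-elim (ne (vecEq-true a b eq))
... | false = refl

leV : ∀ {n} → Vec ℕ n → Vec ℕ n → Bool
leV [] [] = true
leV (x ∷ xs) (y ∷ ys) = (x ≤ᵇ y) ∧ leV xs ys

subV : ∀ {n} → Vec ℕ n → Vec ℕ n → Vec ℕ n
subV i e = zipWith _∸_ i e

addV : ∀ {n} → Vec ℕ n → Vec ℕ n → Vec ℕ n
addV = zipWith _+_

scal : ∀ {n} → ℕ → Vec ℕ n → Vec ℕ n
scal a v = Vec.map (a *_) v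

zeros : ∀ {n} → Vec ℕ n
zeros = replicate _ 0

vecEq-zeros : ∀ {n} (is : Vec ℕ n) → vecEq zeros is ≡ (deg is ≡ᵇ 0)
vecEq-zeros [] = refl
vecEq-zeros (zero ∷ is) = vecEq-zeros is
vecEq-zeros (suc x ∷ is) = refl

scal0 : ∀ {n} (v : Vec ℕ n) → scal 0 v ≡ zeros
scal0 [] = refl
scal0 (x ∷ v) = cong (0 ∷_) (scal0 v)

add-scal : ∀ {n} a (v : Vec ℕ n) → addV v (scal a v) ≡ scal (suc a) v
add-scal a [] = refl
add-scal a (x ∷ v) = cong ((x + a * x) ∷_) (add-scal a v)

leV-zeros : ∀ {n} (i : Vec ℕ n) → leV zeros i ≡ true
leV-zeros [] = refl
leV-zeros (x ∷ i) = leV-zeros i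

subV-zeros : ∀ {n} (i : Vec ℕ n) → subV i zeros ≡ i
subV-zeros [] = refl
subV-zeros (x ∷ i) = cong (x ∷_) (subV-zeros i)

mono-cons : ∀ {n} e (es : Vec ℕ n) a as → mono (e ∷ es) (a ∷ as) ≡ guard (e ≡ᵇ a) (mono es as)
mono-cons e es a as with e ≡ᵇ a
... | true = refl
... | false = refl

mono-ne : ∀ {n} (e i : Vec ℕ n) → ¬ e ≡ i → mono e i ≡ 0
mono-ne e i ne rewrite vecEq-false e i ne = refl

mono-g : ∀ {n} (e i : Vec ℕ n) → mono e i ≡ guard (vecEq e i) 1
mono-g e i with vecEq e i
... | true = refl
... | false = refl

below-cons : ∀ {n} (h : Vec ℕ (suc n) → ℕ) x (xs : Vec ℕ n) →
  sum (map h (below (x ∷ xs))) ≡ sum (map (λ a → sum (map (λ as → h (a ∷ as)) (below xs))) (range x))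
below-cons h x xs = trans (sum-concatMap h (λ a → map (a ∷_) (below xs)) (range x))
  (sum-cong (λ a → sum-map-map h (a ∷_) (below xs)) (range x))

sum-mono* : ∀ {n} (i e : Vec ℕ n) (X : Vec ℕ n → ℕ) → sum (map (λ a → mono e a * X a) (below i)) ≡ guard (leV e i) (X e)
sum-mono* [] [] X = trans (+-identityʳ (1 * X [])) (*-identityˡ (X []))
sum-mono* (x ∷ xs) (e ∷ es) X =
  begin
    sum (map (λ a → mono (e ∷ es) a * X a) (below (x ∷ xs)))
      ≡⟨ below-cons _ x xs ⟩
    sum (map (λ a → sum (map (λ as → mono (e ∷ es) (a ∷ as) * X (a ∷ as)) (below xs))) (range x))
      ≡⟨ sum-cong (λ a → trans (sum-cong (λ as → trans (cong (_* X (a ∷ as)) (mono-cons e es a as)) (guard-* (e ≡ᵇ a) _ _)) (below xs))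
                          (trans (sum-guard (e ≡ᵇ a) _ (below xs)) (cong (guard (e ≡ᵇ a)) (sum-mono* xs es (λ as → X (a ∷ as)))))) (range x) ⟩
    sum (map (λ a → guard (e ≡ᵇ a) (guard (leV es xs) (X (a ∷ es)))) (range x))
      ≡⟨ sum-range-at x e _ ⟩
    guard (e ≤ᵇ x) (guard (leV es xs) (X (e ∷ es)))
      ≡⟨ guard-∧ (e ≤ᵇ x) _ _ ⟩
    guard (leV (e ∷ es) (x ∷ xs)) (X (e ∷ es))
  ∎

sum-*mono : ∀ {n} (i e : Vec ℕ n) (X : Vec ℕ n → ℕ) → sum (map (λ a → X a * mono e (subV i a)) (below i)) ≡ guard (leV e i) (X (subV i e))
sum-*mono [] [] X = trans (+-identityʳ (X [] * 1)) (*-identityʳ (X []))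
sum-*mono (x ∷ xs) (e ∷ es) X =
  begin
    sum (map (λ a → X a * mono (e ∷ es) (subV (x ∷ xs) a)) (below (x ∷ xs)))
      ≡⟨ below-cons _ x xs ⟩
    sum (map (λ a → sum (map (λ as → X (a ∷ as) * mono (e ∷ es) ((x ∸ a) ∷ subV xs as)) (below xs))) (range x))
      ≡⟨ sum-cong (λ a → trans (sum-cong (λ as → trans (cong (X (a ∷ as) *_) (mono-cons e es (x ∸ a) (subV xs as)))
                                                   (trans (*-comm (X (a ∷ as)) _) (trans (guard-* (e ≡ᵇ x ∸ a) _ _) (cong (guard (e ≡ᵇ x ∸ a)) (*-comm _ (X (a ∷ as))))))) (below xs))
                          (trans (sum-guard (e ≡ᵇ x ∸ a) _ (below xs)) (cong (guard (e ≡ᵇ x ∸ a)) (sum-*mono xs es (λ as → X (a ∷ as)))))) (range x) ⟩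
    sum (map (λ a → guard (e ≡ᵇ x ∸ a) (guard (leV es xs) (X (a ∷ subV xs es)))) (range x))
      ≡⟨ sum-range-at-∸ x e _ ⟩
    guard (e ≤ᵇ x) (guard (leV es xs) (X ((x ∸ e) ∷ subV xs es)))
      ≡⟨ guard-∧ (e ≤ᵇ x) _ _ ⟩
    guard (leV (e ∷ es) (x ∷ xs)) (X (subV (x ∷ xs) (e ∷ es)))
  ∎

mono*ₛ : ∀ {n} (e : Vec ℕ n) (F : FPS n) i → (mono e *ₛ F) i ≡ guard (leV e i) (F (subV i e))
mono*ₛ e F i = sum-mono* i e (λ a → F (subV i a))

*ₛmono : ∀ {n} (e : Vec ℕ n) (F : FPS n) i → (F *ₛ mono e) i ≡ guard (leV e i) (F (subV i e))
*ₛmono e F i = sum-*mono i e F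

*ₛ-congʳ : ∀ {n} (F : FPS n) {G H : FPS n} → G ≈ H → (F *ₛ G) ≈ (F *ₛ H)
*ₛ-congʳ F e i = sum-cong (λ a → cong (F a *_) (e (zipWith _∸_ i a))) (below i)

*ₛ-congˡ : ∀ {n} {F G : FPS n} (H : FPS n) → F ≈ G → (F *ₛ H) ≈ (G *ₛ H)
*ₛ-congˡ H e i = sum-cong (λ a → cong (_* H (zipWith _∸_ i a)) (e a)) (below i)

guard-mono-subV : ∀ {n} (e e' i : Vec ℕ n) → guard (leV e i) (mono e' (subV i e)) ≡ mono (addV e e') i
guard-mono-subV [] [] [] = refl
guard-mono-subV (e ∷ es) (e' ∷ es') (x ∷ xs) =
  begin
    guard ((e ≤ᵇ x) ∧ leV es xs) (mono (e' ∷ es') ((x ∸ e) ∷ subV xs es))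
      ≡⟨ cong (guard ((e ≤ᵇ x) ∧ leV es xs)) (mono-cons e' es' (x ∸ e) (subV xs es)) ⟩
    guard ((e ≤ᵇ x) ∧ leV es xs) (guard (e' ≡ᵇ x ∸ e) (mono es' (subV xs es)))
      ≡⟨ sym (guard-∧ (e ≤ᵇ x) _ _) ⟩
    guard (e ≤ᵇ x) (guard (leV es xs) (guard (e' ≡ᵇ x ∸ e) (mono es' (subV xs es))))
      ≡⟨ cong (guard (e ≤ᵇ x)) (guard-comm (leV es xs) (e' ≡ᵇ x ∸ e) (mono es' (subV xs es))) ⟩
    guard (e ≤ᵇ x) (guard (e' ≡ᵇ x ∸ e) (guard (leV es xs) (mono es' (subV xs es))))
      ≡⟨ guard-∧ (e ≤ᵇ x) _ _ ⟩
    guard ((e ≤ᵇ x) ∧ (e' ≡ᵇ x ∸ e)) (guard (leV es xs) (mono es' (subV xs es)))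
      ≡⟨ cong₂ guard (≤ᵇ∧≡ᵇ∸≡≡ᵇ+ e e' x) (guard-mono-subV es es' xs) ⟩
    guard (e + e' ≡ᵇ x) (mono (addV es es') xs)
      ≡⟨ sym (mono-cons (e + e') (addV es es') x xs) ⟩
    mono (addV (e ∷ es) (e' ∷ es')) (x ∷ xs)
  ∎

mono-mul : ∀ {n} (e e' : Vec ℕ n) → (mono e *ₛ mono e') ≈ mono (addV e e')
mono-mul e e' i = trans (mono*ₛ e (mono e') i) (guard-mono-subV e e' i)

mono-pow : ∀ {n} (e : Vec ℕ n) a → (mono e ^ₛ a) ≈ mono (scal a e)
mono-pow e zero i = cong (λ v → mono v i) (sym (scal0 e))
mono-pow e (suc a) i = trans (*ₛ-congʳ (mono e) (mono-pow e a) i) (trans (mono-mul e (scal a e) i) (cong (λ v → mono v i) (add-scal a e)))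

*-one : ∀ {n} (F : FPS n) → (F *ₛ oneₛ) ≈ F
*-one F i = trans (*ₛmono zeros F i) (trans (guard-t _ (leV-zeros i)) (cong F (subV-zeros i)))

^-congˡ : ∀ {n} {F G : FPS n} → F ≈ G → ∀ u → (F ^ₛ u) ≈ (G ^ₛ u)
^-congˡ e zero i = refl
^-congˡ {F = F} {G} e (suc u) i = trans (*ₛ-congˡ (F ^ₛ u) e i) (*ₛ-congʳ G (^-congˡ e u) i)

prodPow-cong : ∀ {r m} (gs hs : Vec (FPS r) m) → (∀ l → lookup gs l ≈ lookup hs l) → ∀ a → prodPow gs a ≈ prodPow hs a
prodPow-cong [] [] e [] i = refl
prodPow-cong (g ∷ gs) (h ∷ hs) e (a ∷ as) i =
  trans (*ₛ-congˡ (prodPow gs as) (^-congˡ (e Fin.zero) a) i) (*ₛ-congʳ (h ^ₛ a) (prodPow-cong gs hs (λ l → e (Fin.suc l)) as) i)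

last : ∀ {n} → Vec ℕ (suc n) → ℕ
last (x ∷ []) = x
last (x ∷ y ∷ ys) = last (y ∷ ys)

last-∷ : ∀ {n} x (v : Vec ℕ (suc n)) → last (x ∷ v) ≡ last v
last-∷ x (y ∷ v) = refl

last-replicate : ∀ n c → last (replicate (suc n) c) ≡ c
last-replicate zero c = refl
last-replicate (suc n) c = last-replicate n c

last≤deg : ∀ {n} (v : Vec ℕ (suc n)) → last v ≤ deg v
last≤deg (x ∷ []) = m≤m+n x 0
last≤deg (x ∷ y ∷ ys) = ≤-trans (last≤deg (y ∷ ys)) (m≤n+m _ x)

leV-rep' : ∀ n d C → (d ≤ᵇ C) ≡ true → leV (replicate n d) (replicate n C) ≡ true
leV-rep' zero d C e = refl
leV-rep' (suc n) d C e = ∧-intro e (leV-rep' n d C e)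

leV-rep : ∀ n d C → leV (replicate (suc n) d) (replicate (suc n) C) ≡ (d ≤ᵇ C)
leV-rep n d C with d ≤ᵇ C in eq
... | true = leV-rep' n d C eq
... | false = refl

subV-rep : ∀ n C d → subV (replicate n C) (replicate n d) ≡ replicate n (C ∸ d)
subV-rep zero C d = refl
subV-rep (suc n) C d = cong ((C ∸ d) ∷_) (subV-rep n C d)

rep-recover : ∀ {n} (ys : Vec ℕ n) d c → leV (replicate n d) ys ≡ true → subV ys (replicate n d) ≡ replicate n c → ys ≡ replicate n (c + d)
rep-recover [] d c _ _ = refl
rep-recover (y ∷ ys) d c le e =
  cong₂ _∷_ (trans (sym (m∸n+n≡m (≤ᵇ≡true⇒≤ {d} {y} (∧-elimˡ le)))) (cong (_+ d) (VP.∷-injectiveˡ e)))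
            (rep-recover ys d c (∧-elimʳ {d ≤ᵇ y} le) (VP.∷-injectiveʳ e))

shift : ∀ {n} → FPS n → FPS (suc n)
shift F (x ∷ j) = guard (0 ≡ᵇ x) (F j)

shift-mul : ∀ {n} (F G : FPS n) → (shift F *ₛ shift G) ≈ shift (F *ₛ G)
shift-mul F G (x ∷ j) =
  begin
    (shift F *ₛ shift G) (x ∷ j)
      ≡⟨ below-cons _ x j ⟩
    sum (map (λ a → sum (map (λ as → guard (0 ≡ᵇ a) (F as) * guard (0 ≡ᵇ x ∸ a) (G (subV j as))) (below j))) (range x))
      ≡⟨ sum-cong (λ a → trans (sum-cong (λ as → guard-* (0 ≡ᵇ a) _ _) (below j)) (sum-guard (0 ≡ᵇ a) _ (below j))) (range x) ⟩
    sum (map (λ a → guard (0 ≡ᵇ a) (sum (map (λ as → F as * guard (0 ≡ᵇ x ∸ a) (G (subV j as))) (below j)))) (range x))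
      ≡⟨ sum-range-at x 0 _ ⟩
    sum (map (λ as → F as * guard (0 ≡ᵇ x) (G (subV j as))) (below j))
      ≡⟨ trans (sum-cong (λ as → *-guard (F as) (0 ≡ᵇ x) _) (below j)) (sum-guard (0 ≡ᵇ x) _ (below j)) ⟩
    shift (F *ₛ G) (x ∷ j)
  ∎

shift-cong : ∀ {n} {F G : FPS n} → F ≈ G → shift F ≈ shift G
shift-cong e (x ∷ j) = cong (guard (0 ≡ᵇ x)) (e j)

shift-one : ∀ {n} → (oneₛ {suc n}) ≈ shift (oneₛ {n})
shift-one (x ∷ j) = mono-cons 0 zeros x j

shift-pow : ∀ {n} (F : FPS n) u → (shift F ^ₛ u) ≈ shift (F ^ₛ u)
shift-pow F zero = shift-one
shift-pow F (suc u) i = trans (*ₛ-congʳ (shift F) (shift-pow F u) i) (shift-mul F (F ^ₛ u) i)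

prodPow-shift : ∀ {r m} (gs : Vec (FPS r) m) a → prodPow (Vec.map shift gs) a ≈ shift (prodPow gs a)
prodPow-shift [] [] = shift-one
prodPow-shift (g ∷ gs) (a ∷ as) i =
  trans (*ₛ-congˡ (prodPow (Vec.map shift gs) as) (shift-pow g a) i)
    (trans (*ₛ-congʳ (shift (g ^ₛ a)) (prodPow-shift gs as) i) (shift-mul (g ^ₛ a) (prodPow gs as) i))

tabulate-const : ∀ n (c : ℕ) → tabulate {n = n} (λ _ → c) ≡ replicate n c
tabulate-const zero c = refl
tabulate-const (suc n) c = cong (c ∷_) (tabulate-const n c)

var-shift : ∀ n l → var (suc n) (suc l) ≈ shift (var n l)
var-shift n l (x ∷ j) = mono-cons 0 (unitVec n l) x j

unitVec-0 : ∀ n → unitVec (suc n) 0 ≡ 1 ∷ zeros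
unitVec-0 n = cong (1 ∷_) (tabulate-const n 0)

var0^ : ∀ n a → (var (suc n) 0 ^ₛ a) ≈ mono (a ∷ zeros)
var0^ n a i = trans (mono-pow (unitVec (suc n) 0) a i)
   (cong (λ v → mono v i) (trans (cong (scal a) (unitVec-0 n)) (cong₂ _∷_ (*-identityʳ a) (scal-zeros n))))
  where
  scal-zeros : ∀ n → scal a (zeros {n}) ≡ zeros
  scal-zeros zero = refl
  scal-zeros (suc n) = cong₂ _∷_ (*-zeroʳ a) (scal-zeros n)

var0^*shift : ∀ {n} a (F : FPS n) x j → (mono (a ∷ zeros) *ₛ shift F) (x ∷ j) ≡ guard (a ≡ᵇ x) (F j)
var0^*shift a F x j =
  trans (mono*ₛ (a ∷ zeros) (shift F) (x ∷ j))
    (trans (cong (λ b → guard ((a ≤ᵇ x) ∧ b) (guard (0 ≡ᵇ x ∸ a) (F (subV j zeros)))) (leV-zeros j))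
      (trans (cong (λ v → guard ((a ≤ᵇ x) ∧ true) (guard (0 ≡ᵇ x ∸ a) (F v))) (subV-zeros j))
        (trans (cong (λ b → guard b (guard (0 ≡ᵇ x ∸ a) (F j))) (∧-identityʳ (a ≤ᵇ x)))
          (trans (guard-∧ (a ≤ᵇ x) _ _) (cong (λ b → guard b (F j)) (trans (≤ᵇ∧≡ᵇ∸≡≡ᵇ+ a 0 x) (cong (_≡ᵇ x) (+-identityʳ a))))))))

liftTail : ∀ {n} → Vec ℕ n → ℕ → Vec ℕ (suc n)
liftTail [] c = c ∷ []
liftTail (x ∷ xs) c = (x + c) ∷ liftTail xs c

snoc0 : ∀ {n} → Vec ℕ n → Vec ℕ (suc n)
snoc0 [] = 0 ∷ []
snoc0 (x ∷ xs) = x ∷ snoc0 xs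

liftTail-match : ∀ {n} (ys : Vec ℕ n) (zs : Vec ℕ (suc n)) c → (leV (snoc0 ys) zs ∧ vecEq (replicate (suc n) c) (subV zs (snoc0 ys))) ≡ vecEq (liftTail ys c) zs
liftTail-match [] (z ∷ []) c = refl
liftTail-match (x ∷ xs) (z ∷ zs) c =
  trans (∧-shuffle (x ≤ᵇ z) (leV (snoc0 xs) zs) (c ≡ᵇ z ∸ x) _)
    (cong₂ _∧_ (≤ᵇ∧≡ᵇ∸≡≡ᵇ+ x c z) (liftTail-match xs zs c))

last-subV-snoc0 : ∀ {n} (ys : Vec ℕ n) (zs : Vec ℕ (suc n)) → last (subV zs (snoc0 ys)) ≡ last zs
last-subV-snoc0 [] (z ∷ []) = refl
last-subV-snoc0 (x ∷ xs) (z ∷ zs) = trans (last-∷ (z ∸ x) (subV zs (snoc0 xs))) (trans (last-subV-snoc0 xs zs) (sym (last-∷ z zs)))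

shift-vars : ∀ m (l : Fin m) → lookup (tabulate (λ l → var (suc (suc m)) (suc (toℕ l)))) l ≈ lookup (Vec.map shift (tabulate (λ l → var (suc m) (toℕ l)))) l
shift-vars m l v = trans (cong (λ F → F v) (VP.lookup∘tabulate (λ l → var (suc (suc m)) (suc (toℕ l))) l))
  (trans (var-shift (suc m) (toℕ l) v) (sym (trans (cong (λ F → F v) (VP.lookup-map l shift (tabulate (λ l → var (suc m) (toℕ l)))))
    (cong (λ F → shift F v) (VP.lookup∘tabulate (λ l → var (suc m) (toℕ l)) l)))))

prodPow-vars : ∀ m (as : Vec ℕ m) → prodPow (tabulate {n = m} (λ l → var (suc m) (toℕ l))) as ≈ mono (snoc0 as)
prodPow-vars zero [] i = refl
prodPow-vars (suc m) (a ∷ as) (x ∷ j) =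
  begin
    ((var (suc (suc m)) 0 ^ₛ a) *ₛ prodPow (tabulate (λ l → var (suc (suc m)) (suc (toℕ l)))) as) (x ∷ j)
      ≡⟨ *ₛ-congˡ (prodPow (tabulate (λ l → var (suc (suc m)) (suc (toℕ l)))) as) (var0^ (suc m) a) (x ∷ j) ⟩
    (mono (a ∷ zeros) *ₛ prodPow (tabulate (λ l → var (suc (suc m)) (suc (toℕ l)))) as) (x ∷ j)
      ≡⟨ *ₛ-congʳ (mono (a ∷ zeros)) (λ v → trans (prodPow-cong (tabulate (λ l → var (suc (suc m)) (suc (toℕ l)))) (Vec.map shift (tabulate (λ l → var (suc m) (toℕ l))))
              (shift-vars m) as v)
            (trans (prodPow-shift (tabulate (λ l → var (suc m) (toℕ l))) as v) (shift-cong (prodPow-vars m as) v))) (x ∷ j) ⟩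
    (mono (a ∷ zeros) *ₛ shift (mono (snoc0 as))) (x ∷ j)
      ≡⟨ var0^*shift a (mono (snoc0 as)) x j ⟩
    guard (a ≡ᵇ x) (mono (snoc0 as) j)
      ≡⟨ sym (mono-cons a (snoc0 as) x j) ⟩
    mono (snoc0 (a ∷ as)) (x ∷ j)
  ∎

multichoose : ℕ → ℕ → ℕ
multichoose zero zero = 1
multichoose zero (suc c) = 0
multichoose (suc s) zero = 1
multichoose (suc s) (suc c) = multichoose s (suc c) + multichoose (suc s) c

multichoose-0 : ∀ s → multichoose s 0 ≡ 1
multichoose-0 zero = refl
multichoose-0 (suc s) = refl

multichoose-1 : ∀ c → multichoose 1 c ≡ 1
multichoose-1 zero = refl
multichoose-1 (suc c) = multichoose-1 c

multichoose-0* : ∀ s x → multichoose s 0 * x ≡ x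
multichoose-0* s x rewrite multichoose-0 s = +-identityʳ x

multichoose-hockey : ∀ u C → sumBelow (suc C) (λ c1 → multichoose u (C ∸ c1)) ≡ multichoose (suc u) C
multichoose-hockey u zero rewrite multichoose-0 u = refl
multichoose-hockey u (suc C) = cong (multichoose u (suc C) +_) (multichoose-hockey u C)

-- Walks with a budget of visits per level

decAt : (ℕ → ℕ) → ℕ → ℕ → ℕ
decAt f l j = if j ≡ᵇ l then f j ∸ 1 else f j

total : ℕ → (ℕ → ℕ) → ℕ
total zero f = 0
total (suc R) f = f (suc R) + total R f

isWalk : ℕ → ℕ → ℕ → (ℕ → ℕ) → List Bool → Bool
isWalk k R z f [] = (z ≡ᵇ 1) ∧ (total R f ≡ᵇ 0)
isWalk k R z f (true ∷ ss) = ((suc z ≤ᵇ R) ∧ (1 ≤ᵇ f (suc z))) ∧ isWalk k R (suc z) (decAt f (suc z)) ss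
isWalk k R z f (false ∷ ss) = ((k ≤ᵇ z) ∧ (1 ≤ᵇ f (z ∸ (k ∸ 1)))) ∧ isWalk k R (z ∸ (k ∸ 1)) (decAt f (z ∸ (k ∸ 1))) ss

-- The number of M-step walks from level z inside [1, R], ending at level 1, that
-- visit each level j exactly f j times; a down step goes from z to z − (k − 1).
walks : ℕ → ℕ → ℕ → ℕ → (ℕ → ℕ) → ℕ
walks k R zero z f = guard ((z ≡ᵇ 1) ∧ (total R f ≡ᵇ 0)) 1
walks k R (suc M) z f = guard ((suc z ≤ᵇ R) ∧ (1 ≤ᵇ f (suc z))) (walks k R M (suc z) (decAt f (suc z)))
                  + guard ((k ≤ᵇ z) ∧ (1 ≤ᵇ f (z ∸ (k ∸ 1)))) (walks k R M (z ∸ (k ∸ 1)) (decAt f (z ∸ (k ∸ 1))))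

countᵇ-∷ : {A : Set} (p : A → Bool) (x : A) (xs : List A) → countᵇ p (x ∷ xs) ≡ guard (p x) 1 + countᵇ p xs
countᵇ-∷ p x xs with p x
... | true = refl
... | false = refl

countᵇ-alternatives : {A B : Set} (p : B → Bool) (a b : A → B) (xs : List A) →
  countᵇ p (concatMap (λ s → a s ∷ b s ∷ []) xs) ≡ countᵇ (λ s → p (a s)) xs + countᵇ (λ s → p (b s)) xs
countᵇ-alternatives p a b [] = refl
countᵇ-alternatives p a b (x ∷ xs)
  rewrite countᵇ-∷ p (a x) (b x ∷ concatMap (λ s → a s ∷ b s ∷ []) xs)
        | countᵇ-∷ p (b x) (concatMap (λ s → a s ∷ b s ∷ []) xs)
        | countᵇ-alternatives p a b xs
        | countᵇ-∷ (λ s → p (a s)) x xs | countᵇ-∷ (λ s → p (b s)) x xs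
  = solve 4 (λ u v m n → u :+ (v :+ (m :+ n)) := (u :+ m) :+ (v :+ n)) refl
      (guard (p (a x)) 1) (guard (p (b x)) 1) (countᵇ (λ s → p (a s)) xs) (countᵇ (λ s → p (b s)) xs)

countᵇ-guard : {A : Set} (b : Bool) (q : A → Bool) (xs : List A) → countᵇ (λ x → b ∧ q x) xs ≡ guard b (countᵇ q xs)
countᵇ-guard true q xs = refl
countᵇ-guard false q [] = refl
countᵇ-guard false q (x ∷ xs) = countᵇ-guard false q xs

countᵇ-cong : {A : Set} {p q : A → Bool} → (∀ x → p x ≡ q x) → (xs : List A) → countᵇ p xs ≡ countᵇ q xs
countᵇ-cong e [] = refl
countᵇ-cong {p = p} {q} e (x ∷ xs) rewrite countᵇ-∷ p x xs | countᵇ-∷ q x xs | e x | countᵇ-cong e xs = refl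

count-isWalk : ∀ k R M z f → countᵇ (isWalk k R z f) (allPaths M) ≡ walks k R M z f
count-isWalk k R zero z f with (z ≡ᵇ 1) ∧ (total R f ≡ᵇ 0)
... | true = refl
... | false = refl
count-isWalk k R (suc M) z f
  rewrite countᵇ-alternatives (isWalk k R z f) (true ∷_) (false ∷_) (allPaths M)
        | countᵇ-guard ((suc z ≤ᵇ R) ∧ (1 ≤ᵇ f (suc z))) (isWalk k R (suc z) (decAt f (suc z))) (allPaths M)
        | countᵇ-guard ((k ≤ᵇ z) ∧ (1 ≤ᵇ f (z ∸ (k ∸ 1)))) (isWalk k R (z ∸ (k ∸ 1)) (decAt f (z ∸ (k ∸ 1)))) (allPaths M)
        | count-isWalk k R M (suc z) (decAt f (suc z))
        | count-isWalk k R M (z ∸ (k ∸ 1)) (decAt f (z ∸ (k ∸ 1)))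
  = refl

total-cong : ∀ R {f g : ℕ → ℕ} → (∀ j → 1 ≤ j → j ≤ R → f j ≡ g j) → total R f ≡ total R g
total-cong zero e = refl
total-cong (suc R) e = cong₂ _+_ (e (suc R) (s≤s z≤n) ≤-refl) (total-cong R (λ j a b → e j a (m≤n⇒m≤1+n b)))

decAt-cong : ∀ {f g : ℕ → ℕ} l → (∀ j → f j ≡ g j) → ∀ j → decAt f l j ≡ decAt g l j
decAt-cong l e j rewrite e j = refl

walks-cong : ∀ k R M z {f g : ℕ → ℕ} → (∀ j → f j ≡ g j) → walks k R M z f ≡ walks k R M z g
walks-cong k R zero z {f} {g} e rewrite total-cong R (λ j _ _ → e j) = refl
walks-cong k R (suc M) z {f} {g} e
  rewrite e (suc z) | e (z ∸ (k ∸ 1))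
        | walks-cong k R M (suc z) (decAt-cong (suc z) e)
        | walks-cong k R M (z ∸ (k ∸ 1)) (decAt-cong (z ∸ (k ∸ 1)) e) = refl

decAt-≢ : ∀ f l j → ¬ j ≡ l → decAt f l j ≡ f j
decAt-≢ f l j ne rewrite ≡ᵇ≡false ne = refl

decAt-self : ∀ f l → decAt f l l ≡ f l ∸ 1
decAt-self f l rewrite ≡ᵇ≡true (refl {x = l}) = refl

decAt-≤ : ∀ g m l → decAt g m l ≤ g l
decAt-≤ g m l with l ≡ᵇ m
... | true = m∸n≤m (g l) 1
... | false = ≤-refl

total-decAt-beyond : ∀ R f l → R < l → total R (decAt f l) ≡ total R f
total-decAt-beyond zero f l _ = refl
total-decAt-beyond (suc R) f l lt rewrite ≡ᵇ≡false {suc R} {l} (λ e → <-irrefl e lt) =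
  cong (f (suc R) +_) (total-decAt-beyond R f l (<-trans (n<1+n R) lt))

suc-total-decAt : ∀ R f l → 1 ≤ l → l ≤ R → 1 ≤ f l → suc (total R (decAt f l)) ≡ total R f
suc-total-decAt zero f l p q r with ≤-trans p q
... | ()
suc-total-decAt (suc R) f l p q r with l ≟ suc R
... | yes refl rewrite ≡ᵇ≡true (refl {x = suc R}) | total-decAt-beyond R f (suc R) (n<1+n R) =
  cong (_+ total R f) (suc[m∸1]≡m r)
... | no ne rewrite ≡ᵇ≡false {suc R} {l} (λ e → ne (sym e)) =
  trans (sym (+-suc (f (suc R)) _)) (cong (f (suc R) +_) (suc-total-decAt R f l p (≤-pred-≢ q ne) r))

total≡0⇒≡0 : ∀ R f → total R f ≡ 0 → ∀ j → 1 ≤ j → j ≤ R → f j ≡ 0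
total≡0⇒≡0 zero f e j p q with ≤-trans p q
... | ()
total≡0⇒≡0 (suc R) f e j p q with j ≟ suc R | m+n≡0⇒m≡0 (f (suc R)) e | m+n≡0⇒n≡0 (f (suc R)) e
... | yes refl | e1 | _ = e1
... | no ne | _ | e2 with m≤n⇒m<n∨m≡n q
...   | inj₁ (s≤s q') = total≡0⇒≡0 R f e2 j p q'
...   | inj₂ y = ⊥-elim (ne y)

≡0⇒total≡0 : ∀ R f → (∀ j → 1 ≤ j → j ≤ R → f j ≡ 0) → total R f ≡ 0
≡0⇒total≡0 zero f h = refl
≡0⇒total≡0 (suc R) f h rewrite h (suc R) (s≤s z≤n) ≤-refl = ≡0⇒total≡0 R f (λ j p q → h j p (m≤n⇒m≤1+n q))

≤total : ∀ R f → f (suc R) ≤ total (suc R) f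
≤total R f = m≤m+n (f (suc R)) (total R f)

-- Augmented paths are walks

#ups : List Bool → ℕ
#ups ss = countᵇ (λ s → s) ss

#downs : List Bool → ℕ
#downs ss = countᵇ notᵇ ss

length≡#ups+#downs : ∀ ss → length ss ≡ #ups ss + #downs ss
length≡#ups+#downs [] = refl
length≡#ups+#downs (true ∷ ss) = cong suc (length≡#ups+#downs ss)
length≡#ups+#downs (false ∷ ss) = trans (cong suc (length≡#ups+#downs ss)) (sym (+-suc (#ups ss) (#downs ss)))

#downs≤length : ∀ ss → #downs ss ≤ length ss
#downs≤length ss = subst (#downs ss ≤_) (sym (length≡#ups+#downs ss)) (m≤n+m (#downs ss) (#ups ss))

1≤ᵇ⊖≡false : ∀ z n → z ≤ n → (Z.+ 1 Z.≤ᵇ (z ⊖ n)) ≡ false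
1≤ᵇ⊖≡false zero zero _ = refl
1≤ᵇ⊖≡false zero (suc n) _ = refl
1≤ᵇ⊖≡false (suc z) (suc n) (s≤s p) rewrite [1+m]⊖[1+n]≡m⊖n z n = 1≤ᵇ⊖≡false z n p

intEq-+≡≡ᵇ : ∀ j m → intEq (Z.+ j) (Z.+ m) ≡ (j ≡ᵇ m)
intEq-+≡≡ᵇ j m with j ≟ m
... | yes refl rewrite ≤ᵇ≡true (≤-refl {j}) | ≡ᵇ≡true (refl {x = j}) = refl
... | no ne rewrite ≡ᵇ≡false ne with j ≤? m
...   | yes j≤m rewrite ≤ᵇ≡true j≤m = ≤ᵇ≡false (λ m≤j → ne (≤-antisym j≤m m≤j))
...   | no j≰m rewrite ≤ᵇ≡false j≰m = refl

countLevel-∷ : ∀ (j m : ℕ) (L : List ℤ) →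
  countᵇ (intEq (Z.+ j)) (Z.+ m ∷ L) ≡ guard (j ≡ᵇ m) 1 + countᵇ (intEq (Z.+ j)) L
countLevel-∷ j m L rewrite countᵇ-∷ (intEq (Z.+ j)) (Z.+ m) L | intEq-+≡≡ᵇ j m = refl

module Levels (k' R : ℕ) where

  k : ℕ
  k = suc (suc k')

  positive : ℤ → Bool
  positive v = Z.+ 1 Z.≤ᵇ v

  belowR : ℤ → Bool
  belowR v = v Z.≤ᵇ Z.+ R

  Tally : List ℤ → (ℕ → ℕ) → Set
  Tally L f = ∀ j → 1 ≤ j → j ≤ R → countᵇ (intEq (Z.+ j)) L ≡ f j

  Counts : ℕ → (ℕ → ℕ) → List Bool → Set
  Counts z f ss = Tally (levels k (Z.+ z) ss) f

  levels-up : ∀ z ss → levels k (Z.+ z) (true ∷ ss) ≡ Z.+ (suc z) ∷ levels k (Z.+ (suc z)) ss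
  levels-up z ss = cong (λ v → Z.+ v ∷ levels k (Z.+ v) ss) (+-comm z 1)

  levels-down : ∀ z ss → suc k' ≤ z → levels k (Z.+ z) (false ∷ ss) ≡ Z.+ (z ∸ suc k') ∷ levels k (Z.+ (z ∸ suc k')) ss
  levels-down z ss p = cong (λ v → v ∷ levels k v ss) (⊖-≥ p)


  Tally-∷ : ∀ (f : ℕ → ℕ) m (L : List ℤ) → 1 ≤ f m → Tally L (decAt f m) → Tally (Z.+ m ∷ L) f
  Tally-∷ f m L fm c j p q rewrite countLevel-∷ j m L | c j p q with j ≟ m
  ... | yes refl rewrite ≡ᵇ≡true (refl {x = j}) = suc[m∸1]≡m fm
  ... | no ne rewrite ≡ᵇ≡false ne = refl

  Tally-∷⁻¹ : ∀ (f : ℕ → ℕ) m (L : List ℤ) → Tally (Z.+ m ∷ L) f → Tally L (decAt f m)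
  Tally-∷⁻¹ f m L c j p q with c j p q
  ... | e rewrite countLevel-∷ j m L with j ≟ m
  ...   | yes refl rewrite ≡ᵇ≡true (refl {x = j}) = cong (_∸ 1) e
  ...   | no ne rewrite ≡ᵇ≡false ne = e

  Tally-∷⇒1≤ : ∀ (f : ℕ → ℕ) m (L : List ℤ) → 1 ≤ m → m ≤ R → Tally (Z.+ m ∷ L) f → 1 ≤ f m
  Tally-∷⇒1≤ f m L p q c with c m p q
  ... | e rewrite countLevel-∷ m m L | ≡ᵇ≡true (refl {x = m}) = subst (1 ≤_) e (s≤s z≤n)

  balance-down : ∀ m u d → (m + suc k') + u ≡ 1 + suc k' * suc d → m + u ≡ 1 + suc k' * d
  balance-down m u d e = +-cancelʳ-≡ (suc k') (m + u) (1 + suc k' * d) (trans (solve 4 (λ m u k d → m :+ u :+ k := (m :+ k) :+ u) refl m u (suc k') d)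
                      (trans e (solve 2 (λ k d → con 1 :+ k :* (con 1 :+ d) := con 1 :+ k :* d :+ k) refl (suc k') d)))

  balance-down⁻¹ : ∀ m u d → m + u ≡ 1 + suc k' * d → (m + suc k') + u ≡ 1 + suc k' * suc d
  balance-down⁻¹ m u d e = trans (solve 3 (λ m u k → m :+ k :+ u := (m :+ u) :+ k) refl m u (suc k'))
     (trans (cong (_+ suc k') e) (solve 2 (λ k d → con 1 :+ k :* d :+ k := con 1 :+ k :* (con 1 :+ d)) refl (suc k') d))

  path⇒isWalk : ∀ ss z f → all positive (levels k (Z.+ z) ss) ≡ true → all belowR (levels k (Z.+ z) ss) ≡ true →
       Counts z f ss → z + #ups ss ≡ 1 + suc k' * #downs ss → isWalk k R z f ss ≡ true
  path⇒isWalk [] z f a b c d rewrite +-identityʳ z | *-zeroʳ (suc k') | d =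
    cong (true ∧_) (≡ᵇ≡true (≡0⇒total≡0 R f (λ j p q → sym (c j p q))))
  path⇒isWalk (true ∷ ss) z f a b c d =
    let a' = subst (λ L → all positive L ≡ true) (levels-up z ss) a
        b' = subst (λ L → all belowR L ≡ true) (levels-up z ss) b
        c' : Tally (Z.+ suc z ∷ levels k (Z.+ suc z) ss) f
        c' j p q = trans (cong (countᵇ (intEq (Z.+ j))) (sym (levels-up z ss))) (c j p q)
        h1 = ≤ᵇ≡true⇒≤ (∧-elimˡ b')
        h2 = Tally-∷⇒1≤ f (suc z) _ (s≤s z≤n) h1 c'
    in ∧-intro (∧-intro {suc z ≤ᵇ R} (≤ᵇ≡true h1) (≤ᵇ≡true h2))
           (path⇒isWalk ss (suc z) (decAt f (suc z)) (∧-elimʳ a') (∧-elimʳ b') (Tally-∷⁻¹ f (suc z) _ c') (trans (sym (+-suc z _)) d))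
  path⇒isWalk (false ∷ ss) z f a b c d with suc (suc k') ≤? z
  ... | no np = ⊥-elim (not-positive (∧-elimˡ a))
    where
    not-positive : (Z.+ 1 Z.≤ᵇ (z ⊖ suc k')) ≡ true → ⊥
    not-positive e with trans (sym (1≤ᵇ⊖≡false z (suc k') (≤-pred (≰⇒> np)))) e
    ... | ()
  ... | yes p =
    let p' = ≤-trans (n≤1+n (suc k')) p
        m = z ∸ suc k'
        a' = subst (λ L → all positive L ≡ true) (levels-down z ss p') a
        b' = subst (λ L → all belowR L ≡ true) (levels-down z ss p') b
        c' : Tally (Z.+ m ∷ levels k (Z.+ m) ss) f
        c' j p q = trans (cong (countᵇ (intEq (Z.+ j))) (sym (levels-down z ss p'))) (c j p q)
        h1 = ≤ᵇ≡true⇒≤ (∧-elimˡ b')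
        h2 = Tally-∷⇒1≤ f m _ (1≤∸ k' z p) h1 c'
        d' = balance-down m (#ups ss) (#downs ss) (trans (cong (_+ #ups ss) (m∸n+n≡m p')) d)
    in ∧-intro (∧-intro {suc (suc k') ≤ᵇ z} (≤ᵇ≡true p) (≤ᵇ≡true h2))
           (path⇒isWalk ss m (decAt f m) (∧-elimʳ a') (∧-elimʳ b') (Tally-∷⁻¹ f m _ c') d')

  isWalk⇒path : ∀ ss z f → z ≤ R → isWalk k R z f ss ≡ true →
       (all positive (levels k (Z.+ z) ss) ≡ true) × (all belowR (levels k (Z.+ z) ss) ≡ true) ×
       Counts z f ss × (z + #ups ss ≡ 1 + suc k' * #downs ss) × (length ss ≡ total R f)
  isWalk⇒path [] z f zR g = refl , refl ,
    (λ j p q → sym (total≡0⇒≡0 R f (≡ᵇ≡true⇒≡ (∧-elimʳ g)) j p q)) ,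
    trans (+-identityʳ z) (trans (≡ᵇ≡true⇒≡ (∧-elimˡ g)) (cong suc (sym (*-zeroʳ (suc k'))))) ,
    sym (≡ᵇ≡true⇒≡ (∧-elimʳ g))
  isWalk⇒path (true ∷ ss) z f zR g =
    let g1 = ∧-elimˡ {(suc z ≤ᵇ R) ∧ (1 ≤ᵇ f (suc z))} g
        h1 = ≤ᵇ≡true⇒≤ (∧-elimˡ {suc z ≤ᵇ R} g1)
        h2 = ≤ᵇ≡true⇒≤ (∧-elimʳ {suc z ≤ᵇ R} g1)
        (a , b , c , d , e) = isWalk⇒path ss (suc z) (decAt f (suc z)) h1 (∧-elimʳ {(suc z ≤ᵇ R) ∧ (1 ≤ᵇ f (suc z))} g)
    in subst (λ L → all positive L ≡ true) (sym (levels-up z ss)) a ,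
       subst (λ L → all belowR L ≡ true) (sym (levels-up z ss)) (∧-intro (≤ᵇ≡true h1) b) ,
       (λ j p q → trans (cong (countᵇ (intEq (Z.+ j))) (levels-up z ss)) (Tally-∷ f (suc z) _ h2 c j p q)) ,
       trans (+-suc z _) d ,
       trans (cong suc e) (suc-total-decAt R f (suc z) (s≤s z≤n) h1 h2)
  isWalk⇒path (false ∷ ss) z f zR g =
    let g1 = ∧-elimˡ {(suc (suc k') ≤ᵇ z) ∧ (1 ≤ᵇ f (z ∸ suc k'))} g
        p = ≤ᵇ≡true⇒≤ (∧-elimˡ {suc (suc k') ≤ᵇ z} g1)
        p' = ≤-trans (n≤1+n (suc k')) p
        m = z ∸ suc k'
        h2 = ≤ᵇ≡true⇒≤ (∧-elimʳ {suc (suc k') ≤ᵇ z} g1)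
        m1 = 1≤∸ k' z p
        mR = ≤-trans (m∸n≤m z (suc k')) zR
        (a , b , c , d , e) = isWalk⇒path ss m (decAt f m) mR (∧-elimʳ {(suc (suc k') ≤ᵇ z) ∧ (1 ≤ᵇ f (z ∸ suc k'))} g)
    in subst (λ L → all positive L ≡ true) (sym (levels-down z ss p')) (∧-intro (≤ᵇ≡true m1) a) ,
       subst (λ L → all belowR L ≡ true) (sym (levels-down z ss p')) (∧-intro (≤ᵇ≡true mR) b) ,
       (λ j p q → trans (cong (countᵇ (intEq (Z.+ j))) (levels-down z ss p')) (Tally-∷ f m _ h2 c j p q)) ,
       trans (cong (_+ #ups ss) (sym (m∸n+n≡m p'))) (balance-down⁻¹ m (#ups ss) (#downs ss) d) ,
       trans (cong suc e) (suc-total-decAt R f m m1 mR h2)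

levelFun : ∀ {r} → Vec ℕ r → ℕ → ℕ
levelFun [] j = 0
levelFun (x ∷ xs) zero = 0
levelFun (x ∷ xs) (suc zero) = x
levelFun (x ∷ xs) (suc (suc j)) = levelFun xs (suc j)

levelFun-lookup : ∀ {r} (is : Vec ℕ r) (j : Fin r) → levelFun is (suc (toℕ j)) ≡ lookup is j
levelFun-lookup (x ∷ is) Fin.zero = refl
levelFun-lookup (x ∷ is) (Fin.suc j) = levelFun-lookup is j

levelFun-∷ : ∀ {n} y (ys : Vec ℕ n) m → 1 ≤ m → levelFun (y ∷ ys) (suc m) ≡ levelFun ys m
levelFun-∷ y ys (suc m) _ = refl

total-levelFun-∷ : ∀ {r} (x : ℕ) (xs : Vec ℕ r) n → total (suc n) (levelFun (x ∷ xs)) ≡ x + total n (levelFun xs)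
total-levelFun-∷ x xs zero = refl
total-levelFun-∷ x xs (suc n) rewrite total-levelFun-∷ x xs n =
  solve 3 (λ a x b → a :+ (x :+ b) := x :+ (a :+ b)) refl (levelFun xs (suc n)) x (total n (levelFun xs))

total-levelFun : ∀ {r} (is : Vec ℕ r) → total r (levelFun is) ≡ deg is
total-levelFun [] = refl
total-levelFun {suc r} (x ∷ is) = trans (total-levelFun-∷ x is r) (cong (x +_) (total-levelFun is))

vecAllᵇ⇒ : ∀ {r} (p : Fin r → ℕ → Bool) (is : Vec ℕ r) → vecAllᵇ p is ≡ true → ∀ j → p j (lookup is j) ≡ true
vecAllᵇ⇒ p (x ∷ is) e Fin.zero = ∧-elimˡ e
vecAllᵇ⇒ p (x ∷ is) e (Fin.suc j) = vecAllᵇ⇒ (λ j → p (Fin.suc j)) is (∧-elimʳ {p Fin.zero x} e) j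

⇒vecAllᵇ : ∀ {r} (p : Fin r → ℕ → Bool) (is : Vec ℕ r) → (∀ j → p j (lookup is j) ≡ true) → vecAllᵇ p is ≡ true
⇒vecAllᵇ p [] h = refl
⇒vecAllᵇ p (x ∷ is) h = ∧-intro (h Fin.zero) (⇒vecAllᵇ (λ j → p (Fin.suc j)) is (λ j → h (Fin.suc j)))

module Counting (k' : ℕ) {r : ℕ} (is : Vec ℕ r) where

  open Levels k' r

  counted : List Bool → Bool
  counted ss = any (λ n → isAugmented k n ss) (range (deg is)) ∧ hasType k is ss

  Counts⇒vecAllᵇ : ∀ ss → Counts 0 (levelFun is) ss →
    vecAllᵇ (λ j ij → countᵇ (intEq (Z.+ suc (toℕ j))) (levels k (Z.+ 0) ss) ≡ᵇ ij) is ≡ true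
  Counts⇒vecAllᵇ ss c = ⇒vecAllᵇ _ is (λ j → ≡ᵇ≡true (trans (c (suc (toℕ j)) (s≤s z≤n) (toℕ<n j)) (levelFun-lookup is j)))

  vecAllᵇ⇒Counts : ∀ ss →
    vecAllᵇ (λ j ij → countᵇ (intEq (Z.+ suc (toℕ j))) (levels k (Z.+ 0) ss) ≡ᵇ ij) is ≡ true → Counts 0 (levelFun is) ss
  vecAllᵇ⇒Counts ss v (suc m) (s≤s _) q =
    let fj = fromℕ< q
        e = ≡ᵇ≡true⇒≡ (vecAllᵇ⇒ _ is v fj)
    in subst (λ v → countᵇ (intEq (Z.+ suc v)) (levels k (Z.+ 0) ss) ≡ levelFun is (suc m)) (toℕ-fromℕ< q)
         (trans e (sym (trans (cong (λ v → levelFun is (suc v)) (sym (toℕ-fromℕ< q))) (levelFun-lookup is fj))))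

  counted⇒isWalk : ∀ ss → counted ss ≡ true → isWalk k r 0 (levelFun is) ss ≡ true
  counted⇒isWalk ss e =
    let (n , au) = any-elim (λ n → isAugmented k n ss) (range (deg is)) (∧-elimˡ e)
        ht = ∧-elimʳ {any (λ n → isAugmented k n ss) (range (deg is))} e
        rest₁ = ∧-elimʳ {length ss ≡ᵇ k * n + 1} au
        upsE = ≡ᵇ≡true⇒≡ (∧-elimˡ rest₁)
        rest₂ = ∧-elimʳ {#ups ss ≡ᵇ suc k' * n + 1} rest₁
        dnsE = ≡ᵇ≡true⇒≡ (∧-elimˡ rest₂)
        rest₃ = ∧-elimʳ {#downs ss ≡ᵇ n} rest₂
        pos = ∧-elimʳ {firstUp ss} rest₃
        vv = ∧-elimˡ ht
        le = ∧-elimʳ {vecAllᵇ (λ j ij → countᵇ (intEq (Z.+ suc (toℕ j))) (levels k (Z.+ 0) ss) ≡ᵇ ij) is} ht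
    in path⇒isWalk ss 0 (levelFun is) pos le (vecAllᵇ⇒Counts ss vv)
         (trans upsE (trans (+-comm (suc k' * n) 1) (cong (λ v → 1 + suc k' * v) (sym dnsE))))

  isWalk⇒counted : ∀ ss → isWalk k r 0 (levelFun is) ss ≡ true → counted ss ≡ true
  isWalk⇒counted [] ()
  isWalk⇒counted (false ∷ ss) ()
  isWalk⇒counted (true ∷ ss) g =
    let s = true ∷ ss
        (a , b , c , d , e) = isWalk⇒path s 0 (levelFun is) z≤n g
        n = #downs s
        nle : n ≤ deg is
        nle = ≤-trans (#downs≤length s) (≤-reflexive (trans e (total-levelFun is)))
        lenE : length s ≡ k * n + 1
        lenE = trans (length≡#ups+#downs s) (trans (cong (_+ n) d)
                 (solve 2 (λ k n → con 1 :+ k :* n :+ n := (con 1 :+ k) :* n :+ con 1) refl (suc k') n))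
        aug : isAugmented k n s ≡ true
        aug = ∧-intro (≡ᵇ≡true lenE) (∧-intro (≡ᵇ≡true (trans d (+-comm 1 (suc k' * n)))) (∧-intro (≡ᵇ≡true (refl {x = n})) (∧-intro refl a)))
    in ∧-intro (any-applyUpTo (λ n → isAugmented k n s) (λ x → x) (suc (deg is)) n (s≤s nle) aug) (∧-intro (Counts⇒vecAllᵇ s c) b)

  counted≡isWalk : ∀ ss → counted ss ≡ isWalk k r 0 (levelFun is) ss
  counted≡isWalk ss = true⇔true⇒≡ (counted⇒isWalk ss) (isWalk⇒counted ss)

  t≡walks : t k is ≡ walks k r (deg is) 0 (levelFun is)
  t≡walks = trans (countᵇ-cong counted≡isWalk (allPaths (deg is))) (count-isWalk k r (deg is) 0 (levelFun is))

-- Removing the top level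

module RemoveTop (k' q : ℕ) where

  k : ℕ
  k = suc (suc k')

  p : ℕ
  p = suc q

  r₁ : ℕ
  r₁ = suc (q + k')

  r : ℕ
  r = suc r₁


  opaque
    δ : ℕ → ℕ → ℕ
    δ z l = if (p <ᵇ l) ∧ ((l ≤ᵇ z) ∧ (z ≤ᵇ r₁)) then 1 else 0
    ε : ℕ → ℕ → ℕ
    ε z l = if (z ≡ᵇ r) ∧ (l ≡ᵇ p) then 1 else 0

  -- A level l ∈ [p, r₁] with too small a remaining budget: every remaining visit
  -- to r needs its own climb through (p, r₁] and landing at p.  When standing at
  -- z ∈ (p, r₁] the levels (p, z] of the current climb are already paid for (δ),
  -- and when standing at r the landing at p is still owed (ε); with these
  -- corrections the condition is preserved by every step (violated-up/down).
  Violated : ℕ → (ℕ → ℕ) → Set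
  Violated z g = Σ ℕ (λ l → (p ≤ l) × (l ≤ r₁) × (g l + δ z l < g r + ε z l))

  ≢top : ∀ l → l ≤ r₁ → ¬ l ≡ r
  ≢top l le e = <-irrefl e (s≤s le)

  p≤r₁ : p ≤ r₁
  p≤r₁ = s≤s (m≤m+n q k')

  opaque
    unfolding δ ε
    δ-low : ∀ z l → z ≤ p → δ z l ≡ 0
    δ-low z l zp with p <? l
    ... | no np rewrite <ᵇ≡false np = refl
    ... | yes pl rewrite <ᵇ≡true pl | ≤ᵇ≡false {l} {z} (λ lz → <-irrefl refl (<-≤-trans pl (≤-trans lz zp))) = refl

    δ-top : ∀ l → δ r l ≡ 0
    δ-top l rewrite ≤ᵇ≡false {r} {r₁} (λ x → <-irrefl refl x) with p <ᵇ l | l ≤ᵇ r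
    ... | true | true = refl
    ... | true | false = refl
    ... | false | _ = refl

    ε-≢top : ∀ z l → ¬ z ≡ r → ε z l ≡ 0
    ε-≢top z l ne rewrite ≡ᵇ≡false ne = refl

    ε-top : ∀ l → ε r l ≡ (if l ≡ᵇ p then 1 else 0)
    ε-top l rewrite ≡ᵇ≡true (refl {x = r}) = refl

    δ-step : ∀ z l → p ≤ z → suc z ≤ r₁ → δ (suc z) l ≡ δ z l + (if l ≡ᵇ suc z then 1 else 0)
    δ-step z l pz zr rewrite ≤ᵇ≡true zr | ≤ᵇ≡true (≤-trans (n≤1+n z) zr) with l ≟ suc z
    ... | yes refl rewrite ≡ᵇ≡true (refl {x = suc z}) | <ᵇ≡true {p} {suc z} (s≤s pz) | ≤ᵇ≡true (≤-refl {suc z})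
                        | ≤ᵇ≡false {suc z} {z} (λ x → <-irrefl refl x) = refl
    ... | no ne rewrite ≡ᵇ≡false ne with l ≤? z
    ...   | yes lz rewrite ≤ᵇ≡true lz | ≤ᵇ≡true (≤-trans lz (n≤1+n z)) = sym (+-identityʳ _)
    ...   | no nlz rewrite ≤ᵇ≡false nlz | ≤ᵇ≡false {l} {suc z} (λ x → nlz (≤-pred-≢ x ne)) = sym (+-identityʳ _)

    δ-r₁-p : δ r₁ p ≡ 0
    δ-r₁-p rewrite <ᵇ≡false {p} {p} (<-irrefl refl) = refl

    δ-r₁ : ∀ l → p < l → l ≤ r₁ → δ r₁ l ≡ 1
    δ-r₁ l pl lr rewrite <ᵇ≡true pl | ≤ᵇ≡true lr | ≤ᵇ≡true (≤-refl {r₁}) = refl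

  top∸[k-1]≡p : r ∸ suc k' ≡ p
  top∸[k-1]≡p = m+n∸n≡m (suc q) k'

  landing≤q : ∀ z → z ≤ r₁ → z ∸ suc k' ≤ q
  landing≤q z zr = ≤-trans (∸-monoˡ-≤ (suc k') zr) (≤-reflexive (m+n∸n≡m q k'))

  violated-up : ∀ z g → z ≤ r₁ → Violated z g → 1 ≤ g (suc z) → Violated (suc z) (decAt g (suc z))
  violated-up z g zr (l , pl , lr , h) g1 with suc z ≤? p
  ... | yes szp =
    let h0 = subst-< (sym (cong (g l +_) (δ-low z l (≤-trans (n≤1+n z) szp)))) (sym (cong (g r +_) (ε-≢top z l (≢top z zr)))) h
    in l , pl , lr , subst-< (cong (decAt g (suc z) l +_) (δ-low (suc z) l szp))
                       (cong₂ _+_ (decAt-≢ g (suc z) r (λ e → ≢top (suc z) (≤-trans szp p≤r₁) (sym e))) (ε-≢top (suc z) l (≢top (suc z) (≤-trans szp p≤r₁))))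
                       (≤-<-trans (+-monoˡ-≤ 0 (decAt-≤ g (suc z) l)) h0)
  ... | no nszp with suc z ≤? r₁
  ...   | yes szr =
    let pz = ≤-pred (≰⇒> nszp)
        h0 = subst-< refl (sym (cong (g r +_) (ε-≢top z l (≢top z zr)))) h
        eR = cong₂ _+_ (decAt-≢ g (suc z) r (λ e → ≢top (suc z) szr (sym e))) (ε-≢top (suc z) l (≢top (suc z) szr))
    in l , pl , lr , subst-< (cong (decAt g (suc z) l +_) (δ-step z l pz szr)) eR (budget-step l h0)
    where
    budget-step : ∀ l → g l + δ z l < g r + 0 → decAt g (suc z) l + (δ z l + (if l ≡ᵇ suc z then 1 else 0)) < g r + 0
    budget-step l h0 with l ≟ suc z
    ... | yes refl = subst-< (cong₂ _+_ (decAt-self g (suc z)) (cong (δ z (suc z) +_) (cong (λ b → if b then 1 else 0) (≡ᵇ≡true (refl {x = suc z})))))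
                        (+-identityʳ (g r)) (m+d<n⇒m∸1+[d+1]<n (g (suc z)) (δ z (suc z)) (g r) g1 (subst-< refl (sym (+-identityʳ (g r))) h0))
    ... | no ne = subst-< (cong₂ _+_ (decAt-≢ g (suc z) l ne) (trans (cong (δ z l +_) (cong (λ b → if b then 1 else 0) (≡ᵇ≡false ne))) (+-identityʳ _))) refl h0
  ...   | no nszr =
    let zr1 : z ≡ r₁
        zr1 = ≤-antisym zr (≤-pred (≰⇒> nszr))
    in at-r₁ zr1
    where
    at-r₁ : z ≡ r₁ → Violated (suc z) (decAt g (suc z))
    at-r₁ refl with l ≟ p
    ... | yes refl =
      let h0 = subst-< (sym (cong (g p +_) δ-r₁-p)) (sym (cong (g r +_) (ε-≢top r₁ p (λ e → <-irrefl e ≤-refl)))) h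
      in p , pl , lr , subst-< (cong₂ _+_ (decAt-≢ g r p (λ e → ≢top p p≤r₁ e)) (δ-top p))
                         (cong₂ _+_ (decAt-self g r) (trans (ε-top p) (cong (λ b → if b then 1 else 0) (≡ᵇ≡true (refl {x = p})))))
                         (subst (_< (g r ∸ 1) + 1) (sym (+-identityʳ (g p))) (m<n⇒m<n∸1+1 (g p) (g r) (subst (g p <_) (+-identityʳ (g r)) (subst (_< g r + 0) (+-identityʳ (g p)) h0))))
    ... | no ne =
      let pl' = ≤∧≢⇒< pl (λ e → ne (sym e))
          h0 = subst-< (sym (cong (g l +_) (δ-r₁ l pl' lr))) (sym (cong (g r +_) (ε-≢top r₁ l (λ e → <-irrefl e ≤-refl)))) h
      in l , pl , lr , subst-< (cong₂ _+_ (decAt-≢ g r l (λ e → ≢top l lr e)) (δ-top l))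
                         (cong₂ _+_ (decAt-self g r) (trans (ε-top l) (cong (λ b → if b then 1 else 0) (≡ᵇ≡false ne))))
                         (subst (_< (g r ∸ 1) + 0) (sym (+-identityʳ (g l))) (subst (g l <_) (sym (+-identityʳ _)) (m+1<n⇒m<n∸1 (g l) (g r) (subst (g l + 1 <_) (+-identityʳ (g r)) h0))))

  violated-down-top : ∀ g → Violated r g → 1 ≤ g p → Violated p (decAt g p)
  violated-down-top g (l , pl , lr , h) g1 with l ≟ p
  ... | yes refl =
    let h0 : g p ≤ g r
        h0 = ≤-pred (subst-< (sym (trans (cong (g p +_) (δ-top p)) (+-identityʳ (g p))))
                        (sym (trans (cong (g r +_) (trans (ε-top p) (cong (λ b → if b then 1 else 0) (≡ᵇ≡true (refl {x = p}))))) (+-comm (g r) 1))) h)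
    in p , pl , lr , subst-< (cong₂ _+_ (decAt-self g p) (δ-low p p ≤-refl))
                        (cong₂ _+_ (decAt-≢ g p r (λ e → ≢top p p≤r₁ (sym e))) (ε-≢top p p (≢top p p≤r₁)))
                        (subst (_< g r + 0) (sym (+-identityʳ _)) (subst ((g p ∸ 1) <_) (sym (+-identityʳ _)) (<-≤-trans (∸-monoʳ-< (s≤s z≤n) g1) h0)))
  ... | no ne =
    let h0 = subst-< (sym (cong (g l +_) (δ-top l))) (sym (trans (cong (g r +_) (trans (ε-top l) (cong (λ b → if b then 1 else 0) (≡ᵇ≡false ne)))) refl)) h
    in l , pl , lr , subst-< (cong₂ _+_ (decAt-≢ g p l ne) (δ-low p l ≤-refl))
                        (cong₂ _+_ (decAt-≢ g p r (λ e → ≢top p p≤r₁ (sym e))) (ε-≢top p l (≢top p p≤r₁))) h0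

  violated-down : ∀ z g → z ≤ r → Violated z g → 1 ≤ g (z ∸ suc k') → Violated (z ∸ suc k') (decAt g (z ∸ suc k'))
  violated-down z g zr v g1 with z ≟ r
  ... | yes refl = subst (λ m → Violated m (decAt g m)) (sym top∸[k-1]≡p) (violated-down-top g v (subst (λ m → 1 ≤ g m) top∸[k-1]≡p g1))
  ... | no nzr =
    let zr1 = ≤-pred-≢ zr nzr
        ℓ = z ∸ suc k'
        ℓq = landing≤q z zr1
        (l , pl , lr , h) = v
        h0 = subst-< refl (sym (cong (g r +_) (ε-≢top z l nzr))) h
    in l , pl , lr , subst-< (cong₂ _+_ (decAt-≢ g ℓ l (λ e → <-irrefl (sym e) (≤-trans (s≤s ℓq) pl))) (δ-low ℓ l (≤-trans ℓq (n≤1+n q))))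
                        (cong₂ _+_ (decAt-≢ g ℓ r (λ e → <-irrefl (sym e) (s≤s (≤-trans ℓq (≤-trans (n≤1+n q) p≤r₁))))) (ε-≢top ℓ l (λ e → ≢top ℓ (≤-trans ℓq (≤-trans (n≤1+n q) p≤r₁)) e)))
                        (≤-<-trans (+-monoʳ-≤ (g l) z≤n) h0)

  violated⇒walks≡0 : ∀ F z g → z ≤ r → Violated z g → walks k r F z g ≡ 0
  violated⇒walks≡0 zero z g zr (l , pl , lr , h) with z ≟ r
  ... | yes refl = refl
  ... | no nzr =
    let 1≤gr : 1 ≤ g r
        1≤gr = ≤-trans (s≤s z≤n) (subst (suc (g l + δ z l) ≤_) (trans (cong (g r +_) (ε-≢top z l nzr)) (+-identityʳ (g r))) h)
        total≢0 : ¬ total r g ≡ 0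
        total≢0 e = <-irrefl refl (≤-trans 1≤gr (subst (g r ≤_) e (≤total r₁ g)))
    in guard-≡0 ((z ≡ᵇ 1) ∧ (total r g ≡ᵇ 0)) 1 (λ e → ⊥-elim (total≢0 (≡ᵇ≡true⇒≡ (∧-elimʳ {z ≡ᵇ 1} e))))
  violated⇒walks≡0 (suc F) z g zr v = cong₂ _+_
    (guard-≡0 ((suc z ≤ᵇ r) ∧ (1 ≤ᵇ g (suc z))) _ (λ e →
       let sz = ≤ᵇ≡true⇒≤ (∧-elimˡ {suc z ≤ᵇ r} e)
       in violated⇒walks≡0 F (suc z) (decAt g (suc z)) sz (violated-up z g (≤-pred sz) v (≤ᵇ≡true⇒≤ (∧-elimʳ {suc z ≤ᵇ r} e)))))
    (guard-≡0 ((k ≤ᵇ z) ∧ (1 ≤ᵇ g (z ∸ suc k'))) _ (λ e →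
       violated⇒walks≡0 F (z ∸ suc k') (decAt g (z ∸ suc k')) (≤-trans (m∸n≤m z (suc k')) zr) (violated-down z g zr v (≤ᵇ≡true⇒≤ (∧-elimʳ {k ≤ᵇ z} e)))))


  downPart : ℕ → ℕ → ℕ → (ℕ → ℕ) → ℕ
  downPart R M y f = guard ((k ≤ᵇ y) ∧ (1 ≤ᵇ f (y ∸ suc k'))) (walks k R M (y ∸ suc k') (decAt f (y ∸ suc k')))

  walksRunBelowTop : ℕ → ℕ → ℕ → (ℕ → ℕ) → ℕ
  walksRunBelowTop R zero y f = walks k R 0 y f
  walksRunBelowTop R (suc M) y f = downPart R M y f + guard ((suc y ≤ᵇ r₁) ∧ (1 ≤ᵇ f (suc y))) (walksRunBelowTop R M (suc y) (decAt f (suc y)))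

  walksRunToTop : ℕ → ℕ → (ℕ → ℕ) → ℕ
  walksRunToTop zero y f = 0
  walksRunToTop (suc M) y f = if suc y ≤ᵇ r₁ then guard (1 ≤ᵇ f (suc y)) (walksRunToTop M (suc y) (decAt f (suc y)))
                    else guard (1 ≤ᵇ f (suc y)) (walks k r M (suc y) (decAt f (suc y)))

  walks-split : ∀ M y f → y ≤ r₁ → walks k r M y f ≡ walksRunBelowTop r M y f + walksRunToTop M y f
  walks-split zero y f yr = sym (+-identityʳ _)
  walks-split (suc M) y f yr with suc y ≤? r₁
  ... | yes syr =
    let c = 1 ≤ᵇ f (suc y)
        L = walksRunBelowTop r M (suc y) (decAt f (suc y))
        T' = walksRunToTop M (suc y) (decAt f (suc y))
        dn = downPart r M y f
    in begin
      guard ((suc y ≤ᵇ r) ∧ c) (walks k r M (suc y) (decAt f (suc y))) + dn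
        ≡⟨ cong (_+ dn) (trans (guard-∧t c _ (≤ᵇ≡true (s≤s yr))) (guard-cong c (λ _ → walks-split M (suc y) (decAt f (suc y)) syr))) ⟩
      guard c (L + T') + dn
        ≡⟨ cong (_+ dn) (guard-+ c L T') ⟩
      (guard c L + guard c T') + dn
        ≡⟨ solve 3 (λ a b d → (a :+ b) :+ d := (d :+ a) :+ b) refl (guard c L) (guard c T') dn ⟩
      (dn + guard c L) + guard c T'
        ≡⟨ sym (cong₂ (λ a b → (dn + a) + b) (guard-∧t c L (≤ᵇ≡true syr)) (if-t (guard c T') _ (≤ᵇ≡true syr))) ⟩
      (dn + guard ((suc y ≤ᵇ r₁) ∧ c) L) + (if suc y ≤ᵇ r₁ then guard c T' else guard c (walks k r M (suc y) (decAt f (suc y))))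
      ∎
  ... | no nsyr =
    let c = 1 ≤ᵇ f (suc y)
        dn = downPart r M y f
        X = guard c (walks k r M (suc y) (decAt f (suc y)))
    in begin
      guard ((suc y ≤ᵇ r) ∧ c) (walks k r M (suc y) (decAt f (suc y))) + dn
        ≡⟨ cong (_+ dn) (guard-∧t c _ (≤ᵇ≡true (s≤s yr))) ⟩
      X + dn
        ≡⟨ +-comm X dn ⟩
      dn + X
        ≡⟨ cong (_+ X) (sym (+-identityʳ dn)) ⟩
      (dn + 0) + X
        ≡⟨ sym (cong₂ (λ a b → (dn + a) + b) (guard-∧f c (walksRunBelowTop r M (suc y) (decAt f (suc y))) (≤ᵇ≡false nsyr)) (if-f (guard c (walksRunToTop M (suc y) (decAt f (suc y)))) X (≤ᵇ≡false nsyr))) ⟩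
      (dn + guard ((suc y ≤ᵇ r₁) ∧ c) (walksRunBelowTop r M (suc y) (decAt f (suc y)))) + (if suc y ≤ᵇ r₁ then guard c (walksRunToTop M (suc y) (decAt f (suc y))) else X)
      ∎

  walks≡walksRunBelowTop : ∀ M y f → y ≤ r₁ → walks k r₁ M y f ≡ walksRunBelowTop r₁ M y f
  walks≡walksRunBelowTop zero y f yr = refl
  walks≡walksRunBelowTop (suc M) y f yr =
    trans (+-comm _ (downPart r₁ M y f))
      (cong (downPart r₁ M y f +_) (guard-cong ((suc y ≤ᵇ r₁) ∧ (1 ≤ᵇ f (suc y)))
        (λ e → walks≡walksRunBelowTop M (suc y) (decAt f (suc y)) (≤ᵇ≡true⇒≤ (∧-elimˡ {suc y ≤ᵇ r₁} e)))))

  -- The budget on r levels of the walks obtained from walks with budget A on r₁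
  -- levels by inserting c loops p → p+1 → ⋯ → r → p.
  raise : (ℕ → ℕ) → ℕ → ℕ → ℕ
  raise A c j = if j ≡ᵇ r then c else (if (p ≤ᵇ j) ∧ (j ≤ᵇ r₁) then A j + c else A j)

  raise-top : ∀ A c → raise A c r ≡ c
  raise-top A c rewrite ≡ᵇ≡true (refl {x = r}) = refl

  raise-≢top : ∀ A c j → ¬ j ≡ r → raise A c j ≡ (if (p ≤ᵇ j) ∧ (j ≤ᵇ r₁) then A j + c else A j)
  raise-≢top A c j ne rewrite ≡ᵇ≡false ne = refl

  raise-mid : ∀ A c j → p ≤ j → j ≤ r₁ → raise A c j ≡ A j + c
  raise-mid A c j pj jr = trans (raise-≢top A c j (≢top j jr)) (if-t _ _ (∧-intro (≤ᵇ≡true pj) (≤ᵇ≡true jr)))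

  raise-low : ∀ A c j → j < p → raise A c j ≡ A j
  raise-low A c j jp = trans (raise-≢top A c j (≢top j (≤-trans (<⇒≤ jp) p≤r₁))) (if-f _ _ (cong (_∧ (j ≤ᵇ r₁)) (≤ᵇ≡false (λ x → <-irrefl refl (<-≤-trans jp x)))))

  raise-p : ∀ A c → raise A c p ≡ A p + c
  raise-p A c = raise-mid A c p ≤-refl p≤r₁

  raise-high : ∀ A c j → r < j → raise A c j ≡ A j
  raise-high A c j rj = trans (raise-≢top A c j (λ e → <-irrefl (sym e) rj))
                      (if-f _ _ (trans (cong ((p ≤ᵇ j) ∧_) (≤ᵇ≡false (λ x → <-irrefl refl (≤-trans rj (≤-trans x (n≤1+n r₁)))))) (∧-zeroʳ (p ≤ᵇ j))))

  decAt-raise : ∀ A c ℓ → ¬ ℓ ≡ r → 1 ≤ A ℓ → ∀ j → decAt (raise A c) ℓ j ≡ raise (decAt A ℓ) c j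
  decAt-raise A c ℓ nr 1≤Aℓ j with j ≟ ℓ
  ... | yes refl = trans (decAt-self (raise A c) j) (trans (cong (_∸ 1) (raise-≢top A c j nr))
                     (trans (∸1-if ((p ≤ᵇ j) ∧ (j ≤ᵇ r₁))) (sym (raise-≢top (decAt A j) c j nr))))
    where
    ∸1-if : ∀ b → (if b then A j + c else A j) ∸ 1 ≡ (if b then decAt A j j + c else decAt A j j)
    ∸1-if true = trans (+-∸-comm c 1≤Aℓ) (cong (_+ c) (sym (decAt-self A j)))
    ∸1-if false = sym (decAt-self A j)
  ... | no ne = trans (decAt-≢ (raise A c) ℓ j ne)
                  (cong (λ x → if j ≡ᵇ r then c else (if (p ≤ᵇ j) ∧ (j ≤ᵇ r₁) then x + c else x)) (sym (decAt-≢ A ℓ j ne)))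

  total-raise-0 : ∀ A → total r (raise A 0) ≡ total r₁ A
  total-raise-0 A = cong₂ _+_ (raise-top A 0) (total-cong r₁ (λ j a b →
      trans (raise-≢top A 0 j (≢top j b)) (+0-if ((p ≤ᵇ j) ∧ (j ≤ᵇ r₁)))))
    where
    +0-if : ∀ {j} b → (if b then A j + 0 else A j) ≡ A j
    +0-if true = +-identityʳ _
    +0-if false = refl

  afterTopRun : ℕ → (ℕ → ℕ) → ℕ → ℕ
  afterTopRun y g j = if j ≡ᵇ p then g j ∸ 1 else (if (y <ᵇ j) ∧ (j ≤ᵇ r) then g j ∸ 1 else g j)

  walksRunToTop-0 : ∀ M y g → y ≤ r₁ → g r ≡ 0 → walksRunToTop M y g ≡ 0
  walksRunToTop-0 zero y g yr e = refl
  walksRunToTop-0 (suc M) y g yr e with suc y ≤? r₁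
  ... | yes syr = trans (if-t _ _ (≤ᵇ≡true syr))
         (trans (guard-cong (1 ≤ᵇ g (suc y)) (λ _ → walksRunToTop-0 M (suc y) (decAt g (suc y)) syr (trans (decAt-≢ g (suc y) r (λ x → ≢top (suc y) syr (sym x))) e))) (guard-0 _))
  ... | no nsyr = trans (if-f _ _ (≤ᵇ≡false nsyr)) (top-exhausted (cong g (≤-antisym (s≤s yr) (≰⇒> nsyr))))
    where
    top-exhausted : g (suc y) ≡ g r → guard (1 ≤ᵇ g (suc y)) (walks k r M (suc y) (decAt g (suc y))) ≡ 0
    top-exhausted x rewrite x | e = refl

  walksRunToTop-climb : ∀ d N y g → y + d ≡ r₁ → p ≤ y → (∀ l → y < l → l ≤ r → 1 ≤ g l) → 1 ≤ g p →
           walksRunToTop (N + suc (suc d)) y g ≡ walks k r N p (afterTopRun y g)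
  walksRunToTop-climb zero N y g e py hl hp rewrite +-comm N 2 | trans (sym (+-identityʳ y)) e =
    begin
      (if suc r₁ ≤ᵇ r₁ then guard (1 ≤ᵇ g r) (walksRunToTop (suc N) r (decAt g r)) else guard (1 ≤ᵇ g r) (walks k r (suc N) r (decAt g r)))
        ≡⟨ if-f _ _ (≤ᵇ≡false {suc r₁} {r₁} (λ x → <-irrefl refl x)) ⟩
      guard (1 ≤ᵇ g r) (walks k r (suc N) r (decAt g r))
        ≡⟨ cong (λ b → guard b (walks k r (suc N) r (decAt g r))) (≤ᵇ≡true (hl r (n<1+n r₁) ≤-refl)) ⟩
      guard ((suc r ≤ᵇ r) ∧ (1 ≤ᵇ decAt g r (suc r))) _ + downPart r N r (decAt g r)
        ≡⟨ cong (_+ downPart r N r (decAt g r)) (guard-∧f _ _ (≤ᵇ≡false {suc r} {r} (λ x → <-irrefl refl x))) ⟩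
      downPart r N r (decAt g r)
        ≡⟨ cong (λ m → guard ((k ≤ᵇ r) ∧ (1 ≤ᵇ decAt g r m)) (walks k r N m (decAt (decAt g r) m))) top∸[k-1]≡p ⟩
      guard ((k ≤ᵇ r) ∧ (1 ≤ᵇ decAt g r p)) (walks k r N p (decAt (decAt g r) p))
        ≡⟨ guard-∧t _ _ (≤ᵇ≡true k≤r) ⟩
      guard (1 ≤ᵇ decAt g r p) (walks k r N p (decAt (decAt g r) p))
        ≡⟨ cong (λ b → guard b (walks k r N p (decAt (decAt g r) p))) (≤ᵇ≡true (subst (1 ≤_) (sym (decAt-≢ g r p (≢top p p≤r₁))) hp)) ⟩
      walks k r N p (decAt (decAt g r) p)
        ≡⟨ walks-cong k r N p pointwise ⟩
      walks k r N p (afterTopRun r₁ g)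
    ∎
    where
    k≤r : k ≤ r
    k≤r = s≤s (s≤s (m≤n+m k' q))
    pointwise : ∀ j → decAt (decAt g r) p j ≡ afterTopRun r₁ g j
    pointwise j with j ≟ p
    ... | yes refl = trans (decAt-self (decAt g r) j) (trans (cong (_∸ 1) (decAt-≢ g r j (≢top j p≤r₁))) (sym (if-t _ _ (≡ᵇ≡true (refl {x = j})))))
    ... | no jp = trans (decAt-≢ (decAt g r) p j jp) (trans (decAt-top j) (sym (if-f _ _ (≡ᵇ≡false jp))))
      where
      decAt-top : ∀ j → decAt g r j ≡ (if (r₁ <ᵇ j) ∧ (j ≤ᵇ r) then g j ∸ 1 else g j)
      decAt-top j with j ≟ r
      ... | yes refl = trans (decAt-self g j) (sym (if-t _ _ (∧-intro (<ᵇ≡true (n<1+n r₁)) (≤ᵇ≡true (≤-refl {r})))))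
      ... | no jr with j ≤? r₁
      ...   | yes jr1 = trans (decAt-≢ g r j jr) (sym (if-f _ _ (cong (_∧ (j ≤ᵇ r)) (<ᵇ≡false (λ x → <-irrefl refl (<-≤-trans x jr1))))))
      ...   | no njr1 = trans (decAt-≢ g r j jr) (sym (if-f _ _ (trans (cong (_∧ (j ≤ᵇ r)) (<ᵇ≡true (≰⇒> njr1))) (≤ᵇ≡false (λ x → jr (≤-antisym x (≰⇒> njr1)))))))
  walksRunToTop-climb (suc d) N y g e py hl hp =
    let syr : suc y ≤ r₁
        syr = subst (suc y ≤_) e (subst (_≤ y + suc d) (+-comm y 1) (+-monoʳ-≤ y (s≤s z≤n)))
        e' : suc y + d ≡ r₁
        e' = trans (sym (+-suc y d)) e
    in begin
      walksRunToTop (N + suc (suc (suc d))) y g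
        ≡⟨ cong (λ x → walksRunToTop x y g) (+-suc N (suc (suc d))) ⟩
      walksRunToTop (suc (N + suc (suc d))) y g
        ≡⟨ if-t _ _ (≤ᵇ≡true syr) ⟩
      guard (1 ≤ᵇ g (suc y)) (walksRunToTop (N + suc (suc d)) (suc y) (decAt g (suc y)))
        ≡⟨ cong (λ b → guard b (walksRunToTop (N + suc (suc d)) (suc y) (decAt g (suc y)))) (≤ᵇ≡true (hl (suc y) ≤-refl (≤-trans syr (n≤1+n r₁)))) ⟩
      walksRunToTop (N + suc (suc d)) (suc y) (decAt g (suc y))
        ≡⟨ walksRunToTop-climb d N (suc y) (decAt g (suc y)) e' (≤-trans py (n≤1+n y))
             (λ l a b → subst (1 ≤_) (sym (decAt-≢ g (suc y) l (λ x → <-irrefl (sym x) a))) (hl l (<-trans (n<1+n y) a) b))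
             (subst (1 ≤_) (sym (decAt-≢ g (suc y) p (λ x → <-irrefl x (s≤s py)))) hp) ⟩
      walks k r N p (afterTopRun (suc y) (decAt g (suc y)))
        ≡⟨ walks-cong k r N p pointwise ⟩
      walks k r N p (afterTopRun y g)
    ∎
    where
    pointwise : ∀ j → afterTopRun (suc y) (decAt g (suc y)) j ≡ afterTopRun y g j
    pointwise j with j ≟ p
    ... | yes refl = trans (if-t _ _ (≡ᵇ≡true (refl {x = j}))) (trans (cong (_∸ 1) (decAt-≢ g (suc y) j (λ x → <-irrefl x (s≤s py)))) (sym (if-t _ _ (≡ᵇ≡true (refl {x = j})))))
    ... | no jp = trans (if-f _ _ (≡ᵇ≡false jp)) (trans (climb-step j) (sym (if-f _ _ (≡ᵇ≡false jp))))
      where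
      climb-step : ∀ j → (if (suc y <ᵇ j) ∧ (j ≤ᵇ r) then decAt g (suc y) j ∸ 1 else decAt g (suc y) j) ≡ (if (y <ᵇ j) ∧ (j ≤ᵇ r) then g j ∸ 1 else g j)
      climb-step j with j ≟ suc y
      ... | yes refl =
        let syr' : suc y ≤ r
            syr' = ≤-trans (subst (suc y ≤_) e (subst (_≤ y + suc d) (+-comm y 1) (+-monoʳ-≤ y (s≤s z≤n)))) (n≤1+n r₁)
        in trans (if-f _ _ (cong (_∧ (suc y ≤ᵇ r)) (<ᵇ≡false {suc y} {suc y} (<-irrefl refl)))) (trans (decAt-self g (suc y))
                 (sym (if-t _ _ (∧-intro (<ᵇ≡true (n<1+n y)) (≤ᵇ≡true syr')))))
      ... | no ne rewrite suc<ᵇ y j ne | decAt-≢ g (suc y) j ne = refl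

  walks-0-top : ∀ z g → 1 ≤ g r → walks k r 0 z g ≡ 0
  walks-0-top z g g1 = guard-≡0 ((z ≡ᵇ 1) ∧ (total r g ≡ᵇ 0)) 1
    (λ e → ⊥-elim (<-irrefl refl (≤-trans g1 (subst (g r ≤_) (≡ᵇ≡true⇒≡ (∧-elimʳ {z ≡ᵇ 1} e)) (≤total r₁ g)))))

  TopExceeds : (ℕ → ℕ) → Set
  TopExceeds g = Σ ℕ (λ l → (p ≤ l) × (l ≤ r₁) × (g l < g r))

  TopExceeds-decAt : ∀ g m → ¬ m ≡ r → TopExceeds g → TopExceeds (decAt g m)
  TopExceeds-decAt g m mr (l , pl , lr , h) = l , pl , lr , subst (decAt g m l <_) (sym (decAt-≢ g m r (λ e → mr (sym e)))) (≤-<-trans (decAt-≤ g m l) h)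

  TopExceeds⇒Violated : ∀ ℓ g → ℓ ≤ q → TopExceeds g → Violated ℓ g
  TopExceeds⇒Violated ℓ g ℓq (l , pl , lr , h) = l , pl , lr ,
    subst-< (trans (cong (g l +_) (δ-low ℓ l (≤-trans ℓq (n≤1+n q)))) (+-identityʳ _))
       (trans (cong (g r +_) (ε-≢top ℓ l (≢top ℓ (≤-trans ℓq (≤-trans (n≤1+n q) p≤r₁))))) (+-identityʳ _)) h

  landing≤top : ∀ y → y ≤ r₁ → y ∸ suc k' ≤ r
  landing≤top y yr = ≤-trans (m∸n≤m y (suc k')) (≤-trans yr (n≤1+n r₁))

  landing≢top : ∀ y → y ≤ r₁ → ¬ (y ∸ suc k') ≡ r
  landing≢top y yr = ≢top _ (≤-trans (landing≤q y yr) (≤-trans (n≤1+n q) p≤r₁))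

  TopExceeds⇒walksRunBelowTop≡0 : ∀ F y g → p ≤ y → y ≤ r₁ → TopExceeds g → walksRunBelowTop r F y g ≡ 0
  TopExceeds⇒walksRunBelowTop≡0 zero y g py yr (l , pl , lr , h) = walks-0-top y g (≤-trans (s≤s z≤n) h)
  TopExceeds⇒walksRunBelowTop≡0 (suc F) y g py yr pv = cong₂ _+_
    (guard-≡0 ((k ≤ᵇ y) ∧ (1 ≤ᵇ g (y ∸ suc k'))) _ (λ e →
       violated⇒walks≡0 F (y ∸ suc k') (decAt g (y ∸ suc k')) (landing≤top y yr)
         (TopExceeds⇒Violated _ _ (landing≤q y yr) (TopExceeds-decAt g _ (landing≢top y yr) pv))))
    (guard-≡0 ((suc y ≤ᵇ r₁) ∧ (1 ≤ᵇ g (suc y))) _ (λ e →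
       let syr = ≤ᵇ≡true⇒≤ (∧-elimˡ {suc y ≤ᵇ r₁} e)
       in TopExceeds⇒walksRunBelowTop≡0 F (suc y) (decAt g (suc y)) (≤-trans py (n≤1+n y)) syr (TopExceeds-decAt g (suc y) (≢top (suc y) syr) pv)))

  walksRunBelowTop-starved≡0 : ∀ F y g → 2 ≤ y → y ≤ r₁ → (∀ j → 1 ≤ j → j ≤ q → g j ≡ 0) → walksRunBelowTop r F y g ≡ 0
  walksRunBelowTop-starved≡0 zero y g y2 yr z0 = guard-≡0 ((y ≡ᵇ 1) ∧ (total r g ≡ᵇ 0)) 1 (λ e → ⊥-elim (<-irrefl (sym (≡ᵇ≡true⇒≡ (∧-elimˡ {y ≡ᵇ 1} e))) y2))
  walksRunBelowTop-starved≡0 (suc F) y g y2 yr z0 = cong₂ _+_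
    (guard-≡0 ((k ≤ᵇ y) ∧ (1 ≤ᵇ g (y ∸ suc k'))) _ (λ e →
       let ky = ≤ᵇ≡true⇒≤ (∧-elimˡ {k ≤ᵇ y} e)
           g1 = ≤ᵇ≡true⇒≤ (∧-elimʳ {k ≤ᵇ y} e)
       in ⊥-elim (<-irrefl (sym (z0 _ (1≤∸ k' y ky) (landing≤q y yr))) g1)))
    (guard-≡0 ((suc y ≤ᵇ r₁) ∧ (1 ≤ᵇ g (suc y))) _ (λ e →
       walksRunBelowTop-starved≡0 F (suc y) (decAt g (suc y)) (≤-trans y2 (n≤1+n y)) (≤ᵇ≡true⇒≤ (∧-elimˡ {suc y ≤ᵇ r₁} e))
          (λ j a b → n≤0⇒n≡0 (subst (decAt g (suc y) j ≤_) (z0 j a b) (decAt-≤ g (suc y) j)))))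

  walksRunBelowTop-cong : ∀ R M y {f g : ℕ → ℕ} → (∀ j → f j ≡ g j) → walksRunBelowTop R M y f ≡ walksRunBelowTop R M y g
  walksRunBelowTop-cong R zero y e = walks-cong k R 0 y e
  walksRunBelowTop-cong R (suc M) y {f} {g} e
    rewrite e (suc y) | e (y ∸ suc k')
          | walks-cong k R M (y ∸ suc k') (decAt-cong (y ∸ suc k') e)
          | walksRunBelowTop-cong R M (suc y) (decAt-cong (suc y) e) = refl

  total-decAt : ∀ A M' ℓ → total r₁ A ≡ suc M' → 1 ≤ ℓ → ℓ ≤ r₁ → 1 ≤ A ℓ → total r₁ (decAt A ℓ) ≡ M'
  total-decAt A M' ℓ h a b c = suc-injective (trans (suc-total-decAt r₁ A ℓ a b c) h)

  downPart-raise : ∀ M' c z A → z ≤ r₁ → total r₁ A ≡ suc M' →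
    (∀ ℓ B → ℓ ≤ q → total r₁ B ≡ M' → walks k r (M' + k * c) ℓ (raise B c) ≡ multichoose (B p) c * walks k r₁ M' ℓ B) →
    downPart r (M' + k * c) z (raise A c) ≡ multichoose (A p) c * downPart r₁ M' z A
  downPart-raise M' c z A zr h IH =
    let ℓ = z ∸ suc k'
        ℓq = landing≤q z zr
        ℓp : ℓ < p
        ℓp = s≤s ℓq
        e1 = raise-low A c ℓ ℓp
    in begin
      guard ((k ≤ᵇ z) ∧ (1 ≤ᵇ raise A c ℓ)) (walks k r (M' + k * c) ℓ (decAt (raise A c) ℓ))
        ≡⟨ cong (λ x → guard ((k ≤ᵇ z) ∧ (1 ≤ᵇ x)) (walks k r (M' + k * c) ℓ (decAt (raise A c) ℓ))) e1 ⟩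
      guard ((k ≤ᵇ z) ∧ (1 ≤ᵇ A ℓ)) (walks k r (M' + k * c) ℓ (decAt (raise A c) ℓ))
        ≡⟨ guard-cong ((k ≤ᵇ z) ∧ (1 ≤ᵇ A ℓ)) (λ e →
             let kz = ≤ᵇ≡true⇒≤ (∧-elimˡ {k ≤ᵇ z} e)
                 1≤Aℓ = ≤ᵇ≡true⇒≤ (∧-elimʳ {k ≤ᵇ z} e)
             in trans (walks-cong k r (M' + k * c) ℓ (decAt-raise A c ℓ (landing≢top z zr) 1≤Aℓ))
                 (trans (IH ℓ (decAt A ℓ) ℓq (total-decAt A M' ℓ h (1≤∸ k' z kz) (≤-trans ℓq (≤-trans (n≤1+n q) p≤r₁)) 1≤Aℓ))
                   (cong (λ x → multichoose x c * walks k r₁ M' ℓ (decAt A ℓ)) (decAt-≢ A ℓ p (λ x → <-irrefl (sym x) ℓp))))) ⟩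
      guard ((k ≤ᵇ z) ∧ (1 ≤ᵇ A ℓ)) (multichoose (A p) c * walks k r₁ M' ℓ (decAt A ℓ))
        ≡⟨ sym (*-guard (multichoose (A p) c) _ _) ⟩
      multichoose (A p) c * downPart r₁ M' z A
    ∎

  walks-p-starved≡0 : ∀ Y A c' → A p ≡ 0 → walks k r Y p (decAt (raise A (suc c')) p) ≡ 0
  walks-p-starved≡0 Y A c' a0 =
    violated⇒walks≡0 Y p (decAt (raise A (suc c')) p) (≤-trans p≤r₁ (n≤1+n r₁))
      (p , ≤-refl , p≤r₁ ,
        subst-< (cong₂ _+_ (trans (decAt-self (raise A (suc c')) p) (cong (_∸ 1) (trans (raise-p A (suc c')) (cong (_+ suc c') a0)))) (δ-low p p ≤-refl))
           (cong₂ _+_ (trans (decAt-≢ (raise A (suc c')) p r (λ x → ≢top p p≤r₁ (sym x))) (raise-top A (suc c'))) (ε-≢top p p (≢top p p≤r₁)))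
           (subst (_< suc c' + 0) (sym (+-identityʳ c')) (subst (c' <_) (sym (+-identityʳ (suc c'))) (n<1+n c'))))

  upPart-raise : ∀ M' c z A → z ≤ q → total r₁ A ≡ suc M' →
    (∀ z' B → z' ≤ q → total r₁ B ≡ M' → walks k r (M' + k * c) z' (raise B c) ≡ multichoose (B p) c * walks k r₁ M' z' B) →
    (∀ B → total r₁ B ≡ M' → walks k r (M' + k * c) p (raise B c) ≡ multichoose (suc (B p)) c * walks k r₁ M' p B) →
    guard ((suc z ≤ᵇ r) ∧ (1 ≤ᵇ raise A c (suc z))) (walks k r (M' + k * c) (suc z) (decAt (raise A c) (suc z)))
      ≡ multichoose (A p) c * guard ((suc z ≤ᵇ r₁) ∧ (1 ≤ᵇ A (suc z))) (walks k r₁ M' (suc z) (decAt A (suc z)))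
  upPart-raise M' c z A zq h IHa IHb =
    trans (guard-∧t _ _ (≤ᵇ≡true (≤-trans (s≤s zq) (≤-trans p≤r₁ (n≤1+n r₁)))))
      (trans (by-position (suc z ≤? q))
        (sym (cong (multichoose (A p) c *_) (guard-∧t _ _ (≤ᵇ≡true (≤-trans (s≤s zq) p≤r₁))))))
    where
    sz≤r₁ : suc z ≤ r₁
    sz≤r₁ = ≤-trans (s≤s zq) p≤r₁
    by-position : Dec (suc z ≤ q) →
      guard (1 ≤ᵇ raise A c (suc z)) (walks k r (M' + k * c) (suc z) (decAt (raise A c) (suc z)))
        ≡ multichoose (A p) c * guard (1 ≤ᵇ A (suc z)) (walks k r₁ M' (suc z) (decAt A (suc z)))
    by-position (yes szq) = trans (cong (λ x → guard (1 ≤ᵇ x) (walks k r (M' + k * c) (suc z) (decAt (raise A c) (suc z)))) (raise-low A c (suc z) (s≤s szq)))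
      (trans (guard-cong (1 ≤ᵇ A (suc z)) (λ e →
         let 1≤Aℓ = ≤ᵇ≡true⇒≤ e
         in trans (walks-cong k r (M' + k * c) (suc z) (decAt-raise A c (suc z) (≢top (suc z) sz≤r₁) 1≤Aℓ))
             (trans (IHa (suc z) (decAt A (suc z)) szq (total-decAt A M' (suc z) h (s≤s z≤n) sz≤r₁ 1≤Aℓ))
               (cong (λ x → multichoose x c * walks k r₁ M' (suc z) (decAt A (suc z))) (decAt-≢ A (suc z) p (λ x → <-irrefl (sym x) (s≤s szq)))))))
       (sym (*-guard (multichoose (A p) c) _ _)))
    by-position (no nszq) = at-p (≤-antisym zq (≤-pred (≰⇒> nszq)))
      where
      at-p : z ≡ q →
        guard (1 ≤ᵇ raise A c (suc z)) (walks k r (M' + k * c) (suc z) (decAt (raise A c) (suc z)))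
          ≡ multichoose (A p) c * guard (1 ≤ᵇ A (suc z)) (walks k r₁ M' (suc z) (decAt A (suc z)))
      at-p refl with A p ≟ 0
      ... | no ap = let 1≤Aℓ = n≢0⇒n>0 ap in
        trans (cong (λ x → guard (1 ≤ᵇ x) (walks k r (M' + k * c) p (decAt (raise A c) p))) (raise-p A c))
          (trans (cong (λ b → guard b (walks k r (M' + k * c) p (decAt (raise A c) p))) (≤ᵇ≡true (≤-trans 1≤Aℓ (m≤m+n (A p) c))))
            (trans (walks-cong k r (M' + k * c) p (decAt-raise A c p (≢top p p≤r₁) 1≤Aℓ))
              (trans (IHb (decAt A p) (total-decAt A M' p h (s≤s z≤n) p≤r₁ 1≤Aℓ))
                (trans (cong (λ x → multichoose x c * walks k r₁ M' p (decAt A p)) (trans (cong suc (decAt-self A p)) (suc[m∸1]≡m 1≤Aℓ)))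
                  (cong (multichoose (A p) c *_) (sym (cong (λ b → guard b (walks k r₁ M' p (decAt A p))) (≤ᵇ≡true 1≤Aℓ))))))))
      ... | yes a0 = trans (starved c) (sym (trans (cong (multichoose (A p) c *_) (cong (λ x → guard (1 ≤ᵇ x) (walks k r₁ M' p (decAt A p))) a0)) (*-zeroʳ (multichoose (A p) c))))
        where
        starved : ∀ c → guard (1 ≤ᵇ raise A c p) (walks k r (M' + k * c) p (decAt (raise A c) p)) ≡ 0
        starved zero = cong (λ x → guard (1 ≤ᵇ x) (walks k r (M' + k * 0) p (decAt (raise A 0) p))) (trans (raise-p A 0) (cong (_+ 0) a0))
        starved (suc c') = guard-≡0 _ _ (λ _ → walks-p-starved≡0 (M' + k * suc c') A c' a0)

  walks-raise-base : ∀ z A → walks k r 0 z (raise A 0) ≡ walks k r₁ 0 z A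
  walks-raise-base z A = cong (λ x → guard ((z ≡ᵇ 1) ∧ (x ≡ᵇ 0)) 1) (total-raise-0 A)

  raise-fuel : ∀ M c' → M + k * suc c' ≡ (M + k * c') + suc (suc k')
  raise-fuel M c' = trans (cong (M +_) (*-suc k c')) (trans (sym (+-assoc M k (k * c'))) (trans (cong (_+ k * c') (+-comm M k)) (trans (+-assoc k M (k * c')) (+-comm k (M + k * c')))))

  afterTopRun-raise : ∀ A c' j → afterTopRun p (raise A (suc c')) j ≡ raise A c' j
  afterTopRun-raise A c' j with j ≟ p
  ... | yes refl = trans (if-t _ _ (≡ᵇ≡true (refl {x = j}))) (trans (cong (_∸ 1) (trans (raise-p A (suc c')) (+-suc (A j) c'))) (sym (raise-p A c')))
  ... | no jp = trans (if-f _ _ (≡ᵇ≡false jp)) (above-p (p <? j))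
    where
    above-p : Dec (p < j) → (if (p <ᵇ j) ∧ (j ≤ᵇ r) then raise A (suc c') j ∸ 1 else raise A (suc c') j) ≡ raise A c' j
    above-p (no npj) = trans (if-f _ _ (cong (_∧ (j ≤ᵇ r)) (<ᵇ≡false npj))) (trans (raise-low A (suc c') j (≰⇒> (λ x → npj (≤∧≢⇒< x (λ e → jp (sym e)))))) (sym (raise-low A c' j (≰⇒> (λ x → npj (≤∧≢⇒< x (λ e → jp (sym e))))))))
    above-p (yes pj) with j ≤? r
    ... | no njr = trans (if-f _ _ (trans (cong (_∧ (j ≤ᵇ r)) (<ᵇ≡true pj)) (≤ᵇ≡false njr))) (trans (raise-high A (suc c') j (≰⇒> njr)) (sym (raise-high A c' j (≰⇒> njr))))
    ... | yes jr with j ≟ r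
    ...   | yes refl = trans (if-t _ _ (∧-intro (<ᵇ≡true pj) (≤ᵇ≡true jr))) (trans (cong (_∸ 1) (raise-top A (suc c'))) (sym (raise-top A c')))
    ...   | no ne = let jr1 = ≤-pred-≢ jr ne in
              trans (if-t _ _ (∧-intro (<ᵇ≡true pj) (≤ᵇ≡true jr))) (trans (cong (_∸ 1) (trans (raise-mid A (suc c') j (<⇒≤ pj) jr1) (+-suc (A j) c'))) (sym (raise-mid A c' j (<⇒≤ pj) jr1)))

  mutual
    walks-raise : ∀ M c z A → z ≤ q → total r₁ A ≡ M → walks k r (M + k * c) z (raise A c) ≡ multichoose (A p) c * walks k r₁ M z A
    walks-raise zero zero z A zq h = trans (cong (λ F → walks k r F z (raise A 0)) (*-zeroʳ k)) (trans (walks-raise-base z A) (sym (multichoose-0* (A p) _)))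
    walks-raise zero (suc c') z A zq h =
      let A0 = total≡0⇒≡0 r₁ A h
          ap0 = A0 p (s≤s z≤n) p≤r₁
          E = raise A (suc c')
          Y = c' + suc k' * suc c'
      in trans (cong₂ _+_
           (guard-≡0 ((suc z ≤ᵇ r) ∧ (1 ≤ᵇ E (suc z))) (walks k r Y (suc z) (decAt E (suc z))) (λ e → climb≡0 (suc z ≤? q) (≤ᵇ≡true⇒≤ (∧-elimʳ {suc z ≤ᵇ r} e))))
           (guard-≡0 ((k ≤ᵇ z) ∧ (1 ≤ᵇ E (z ∸ suc k'))) _ (λ e →
              let kz = ≤ᵇ≡true⇒≤ (∧-elimˡ {k ≤ᵇ z} e)
                  ℓq = landing≤q z (≤-trans zq (≤-trans (n≤1+n q) p≤r₁))
                  g1 = ≤ᵇ≡true⇒≤ (∧-elimʳ {k ≤ᵇ z} e)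
              in ⊥-elim (<-irrefl (sym (trans (raise-low A (suc c') _ (s≤s ℓq)) (A0 _ (1≤∸ k' z kz) (≤-trans ℓq (≤-trans (n≤1+n q) p≤r₁))))) g1))))
           (sym (trans (cong (λ x → multichoose x (suc c') * walks k r₁ 0 z A) ap0) refl))
      where
      climb≡0 : Dec (suc z ≤ q) → 1 ≤ raise A (suc c') (suc z) → walks k r (c' + suc k' * suc c') (suc z) (decAt (raise A (suc c')) (suc z)) ≡ 0
      climb≡0 (yes szq) g1 = ⊥-elim (<-irrefl (sym (trans (raise-low A (suc c') (suc z) (s≤s szq)) (total≡0⇒≡0 r₁ A h (suc z) (s≤s z≤n) (≤-trans szq (≤-trans (n≤1+n q) p≤r₁))))) g1)
      climb≡0 (no nszq) g1 = climb-to-p≡0 (≤-antisym zq (≤-pred (≰⇒> nszq)))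
        where
        climb-to-p≡0 : z ≡ q → walks k r (c' + suc k' * suc c') (suc z) (decAt (raise A (suc c')) (suc z)) ≡ 0
        climb-to-p≡0 refl = walks-p-starved≡0 (c' + suc k' * suc c') A c' (total≡0⇒≡0 r₁ A h p (s≤s z≤n) p≤r₁)
    walks-raise (suc M') c z A zq h =
      trans (cong₂ _+_ (upPart-raise M' c z A zq h (λ z' B a b → walks-raise M' c z' B a b) (λ B b → walks-raise-p M' c B b))
                       (downPart-raise M' c z A (≤-trans zq (≤-trans (n≤1+n q) p≤r₁)) h (λ ℓ B a b → walks-raise M' c ℓ B a b)))
            (sym (*-distribˡ-+ (multichoose (A p) c) _ _))

    -- From p the current run either stays below r or is a loop through r: the two
    -- terms of the recursion multichoose (s+1) (c+1) = multichoose s (c+1) + multichoose (s+1) c.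
    walks-raise-p : ∀ M c A → total r₁ A ≡ M → walks k r (M + k * c) p (raise A c) ≡ multichoose (suc (A p)) c * walks k r₁ M p A
    walks-raise-p M zero A h =
      trans (walks-split (M + k * 0) p (raise A 0) p≤r₁)
        (trans (cong₂ _+_ (walksRunBelowTop-raise M 0 p A ≤-refl p≤r₁ h) (walksRunToTop-0 (M + k * 0) p (raise A 0) p≤r₁ (raise-top A 0)))
          (trans (+-identityʳ _) (trans (multichoose-0* (A p) _) (trans (sym (walks≡walksRunBelowTop M p A p≤r₁)) (sym (multichoose-0* (suc (A p)) _))))))
    walks-raise-p M (suc c') A h =
      let E = raise A (suc c')
          D1 = walks k r₁ M p A
      in begin
        walks k r (M + k * suc c') p E
          ≡⟨ walks-split (M + k * suc c') p E p≤r₁ ⟩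
        walksRunBelowTop r (M + k * suc c') p E + walksRunToTop (M + k * suc c') p E
          ≡⟨ cong₂ _+_ (trans (walksRunBelowTop-raise M (suc c') p A ≤-refl p≤r₁ h) (cong (multichoose (A p) (suc c') *_) (sym (walks≡walksRunBelowTop M p A p≤r₁))))
               (trans (cong (λ F → walksRunToTop F p E) (raise-fuel M c'))
                 (trans (walksRunToTop-climb k' (M + k * c') p E refl ≤-refl
                           (λ l pl lr → 1≤above-p l pl lr)
                           (subst (1 ≤_) (sym (raise-p A (suc c'))) (≤-trans (s≤s z≤n) (m≤n+m (suc c') (A p)))))
                   (trans (walks-cong k r (M + k * c') p (afterTopRun-raise A c'))
                     (walks-raise-p M c' A h)))) ⟩
        multichoose (A p) (suc c') * D1 + multichoose (suc (A p)) c' * D1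
          ≡⟨ sym (*-distribʳ-+ D1 (multichoose (A p) (suc c')) (multichoose (suc (A p)) c')) ⟩
        multichoose (suc (A p)) (suc c') * D1
      ∎
      where
      1≤above-p : ∀ l → p < l → l ≤ r → 1 ≤ raise A (suc c') l
      1≤above-p l pl lr with l ≟ r
      ... | yes refl = subst (1 ≤_) (sym (raise-top A (suc c'))) (s≤s z≤n)
      ... | no ne = subst (1 ≤_) (sym (raise-mid A (suc c') l (<⇒≤ pl) (≤-pred-≢ lr ne))) (≤-trans (s≤s z≤n) (m≤n+m (suc c') (A l)))

    walksRunBelowTop-raise : ∀ M c y A → p ≤ y → y ≤ r₁ → total r₁ A ≡ M → walksRunBelowTop r (M + k * c) y (raise A c) ≡ multichoose (A p) c * walksRunBelowTop r₁ M y A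
    walksRunBelowTop-raise zero zero y A py yr h = trans (cong (λ F → walksRunBelowTop r F y (raise A 0)) (*-zeroʳ k)) (trans (walks-raise-base y A) (sym (multichoose-0* (A p) _)))
    walksRunBelowTop-raise zero (suc c') y A py yr h =
      let A0 = total≡0⇒≡0 r₁ A h
          ap0 = A0 p (s≤s z≤n) p≤r₁
          E = raise A (suc c')
      in trans (cong₂ _+_
           (guard-≡0 ((k ≤ᵇ y) ∧ (1 ≤ᵇ E (y ∸ suc k'))) _ (λ e →
              let ky = ≤ᵇ≡true⇒≤ (∧-elimˡ {k ≤ᵇ y} e)
                  ℓq = landing≤q y yr
                  g1 = ≤ᵇ≡true⇒≤ (∧-elimʳ {k ≤ᵇ y} e)
              in ⊥-elim (<-irrefl (sym (trans (raise-low A (suc c') _ (s≤s ℓq)) (A0 _ (1≤∸ k' y ky) (≤-trans ℓq (≤-trans (n≤1+n q) p≤r₁))))) g1)))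
           (guard-≡0 ((suc y ≤ᵇ r₁) ∧ (1 ≤ᵇ E (suc y))) _ (λ e →
              walksRunBelowTop-starved≡0 (c' + suc k' * suc c') (suc y) (decAt E (suc y)) (s≤s (≤-trans (s≤s z≤n) py)) (≤ᵇ≡true⇒≤ (∧-elimˡ {suc y ≤ᵇ r₁} e))
                (λ j a b → n≤0⇒n≡0 (subst (decAt E (suc y) j ≤_) (trans (raise-low A (suc c') j (s≤s b)) (A0 j a (≤-trans b (≤-trans (n≤1+n q) p≤r₁)))) (decAt-≤ E (suc y) j))))))
           (sym (cong (λ x → multichoose x (suc c') * walksRunBelowTop r₁ 0 y A) ap0))
    walksRunBelowTop-raise (suc M') c y A py yr h =
      trans (cong₂ _+_ (downPart-raise M' c y A yr h (λ ℓ B a b → walks-raise M' c ℓ B a b)) (up-step (suc y ≤? r₁)))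
            (sym (*-distribˡ-+ (multichoose (A p) c) _ _))
      where
      E : ℕ → ℕ
      E = raise A c
      up-step : Dec (suc y ≤ r₁) →
        guard ((suc y ≤ᵇ r₁) ∧ (1 ≤ᵇ E (suc y))) (walksRunBelowTop r (M' + k * c) (suc y) (decAt E (suc y)))
          ≡ multichoose (A p) c * guard ((suc y ≤ᵇ r₁) ∧ (1 ≤ᵇ A (suc y))) (walksRunBelowTop r₁ M' (suc y) (decAt A (suc y)))
      up-step (no n) = trans (guard-∧f _ _ (≤ᵇ≡false n)) (sym (trans (cong (multichoose (A p) c *_) (guard-∧f _ _ (≤ᵇ≡false n))) (*-zeroʳ (multichoose (A p) c))))
      up-step (yes syr) = trans (guard-∧t _ _ (≤ᵇ≡true syr))
                        (trans (trans (cong (λ x → guard (1 ≤ᵇ x) (walksRunBelowTop r (M' + k * c) (suc y) (decAt E (suc y)))) (raise-mid A c (suc y) (≤-trans py (n≤1+n y)) syr)) (up-step-budget (A (suc y) ≟ 0)))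
                          (sym (cong (multichoose (A p) c *_) (guard-∧t _ _ (≤ᵇ≡true syr)))))
        where
        p≤sy : p ≤ suc y
        p≤sy = ≤-trans py (n≤1+n y)
        up-step-budget : Dec (A (suc y) ≡ 0) →
          guard (1 ≤ᵇ A (suc y) + c) (walksRunBelowTop r (M' + k * c) (suc y) (decAt E (suc y)))
            ≡ multichoose (A p) c * guard (1 ≤ᵇ A (suc y)) (walksRunBelowTop r₁ M' (suc y) (decAt A (suc y)))
        up-step-budget (no a) = let 1≤Aℓ = n≢0⇒n>0 a in
          trans (cong (λ b → guard b (walksRunBelowTop r (M' + k * c) (suc y) (decAt E (suc y)))) (≤ᵇ≡true (≤-trans 1≤Aℓ (m≤m+n _ c))))
            (trans (walksRunBelowTop-cong r (M' + k * c) (suc y) (decAt-raise A c (suc y) (≢top (suc y) syr) 1≤Aℓ))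
              (trans (walksRunBelowTop-raise M' c (suc y) (decAt A (suc y)) p≤sy syr (total-decAt A M' (suc y) h (s≤s z≤n) syr 1≤Aℓ))
                (trans (cong (λ x → multichoose x c * walksRunBelowTop r₁ M' (suc y) (decAt A (suc y))) (decAt-≢ A (suc y) p (λ x → <-irrefl x (s≤s py))))
                  (cong (multichoose (A p) c *_) (sym (cong (λ b → guard b (walksRunBelowTop r₁ M' (suc y) (decAt A (suc y)))) (≤ᵇ≡true 1≤Aℓ)))))))
        up-step-budget (yes a0) = trans (starved c) (sym (trans (cong (λ x → multichoose (A p) c * guard (1 ≤ᵇ x) (walksRunBelowTop r₁ M' (suc y) (decAt A (suc y)))) a0) (*-zeroʳ (multichoose (A p) c))))
          where
          starved : ∀ c → guard (1 ≤ᵇ A (suc y) + c) (walksRunBelowTop r (M' + k * c) (suc y) (decAt (raise A c) (suc y))) ≡ 0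
          starved zero = cong (λ x → guard (1 ≤ᵇ x) (walksRunBelowTop r (M' + k * 0) (suc y) (decAt (raise A 0) (suc y)))) (cong (_+ 0) a0)
          starved (suc c'') = guard-≡0 (1 ≤ᵇ A (suc y) + suc c'') (walksRunBelowTop r (M' + k * suc c'') (suc y) (decAt (raise A (suc c'')) (suc y))) (λ _ → TopExceeds⇒walksRunBelowTop≡0 (M' + k * suc c'') (suc y) (decAt (raise A (suc c'')) (suc y)) p≤sy syr
            (suc y , p≤sy , syr ,
              subst₂ _<_ (sym (trans (decAt-self (raise A (suc c'')) (suc y)) (cong (_∸ 1) (trans (raise-mid A (suc c'') (suc y) p≤sy syr) (cong (_+ suc c'') a0)))))
                         (sym (trans (decAt-≢ (raise A (suc c'')) (suc y) r (λ x → ≢top (suc y) syr (sym x))) (raise-top A (suc c''))))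
                         (n<1+n c'')))

-- The substituted variable

module Substitute (k' : ℕ) where

  Len : ℕ → ℕ
  Len q = suc (suc (q + k'))

  xp : (q : ℕ) → Vec ℕ (Len q)
  xp zero = 1 ∷ zeros
  xp (suc q) = 0 ∷ xp q

  tailOnes : (q : ℕ) → Vec ℕ (Len q)
  tailOnes zero = replicate _ 1
  tailOnes (suc q) = 0 ∷ tailOnes q

  gpExp : (q : ℕ) → ℕ → ℕ → Vec ℕ (Len q)
  gpExp zero u c = (u + c) ∷ replicate (suc k') c
  gpExp (suc q) u c = 0 ∷ gpExp q u c

  gpCoeff : (q : ℕ) → ℕ → FPS (Len q)
  gpCoeff q u j = guard (vecEq (gpExp q u (last j)) j) (multichoose u (last j))

  last-scal-replicate : ∀ n a → last (scal a (replicate (suc n) 1)) ≡ a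
  last-scal-replicate zero a = *-identityʳ a
  last-scal-replicate (suc n) a = last-scal-replicate n a

  last-scal-tailOnes : ∀ q a → last (scal a (tailOnes q)) ≡ a
  last-scal-tailOnes zero a = last-scal-replicate (suc k') a
  last-scal-tailOnes (suc q) a = trans (last-∷ (a * 0) (scal a (tailOnes q))) (last-scal-tailOnes q a)

  inv1m-tail : ∀ q j → inv1m (mono (tailOnes q)) j ≡ mono (scal (last j) (tailOnes q)) j
  inv1m-tail q j =
    begin
      inv1m (mono (tailOnes q)) j
        ≡⟨ sum-concatMap _ (λ a → map (a ∷_) (box 0 (deg j))) (range (deg j)) ⟩
      sum (map (λ a → sum (map (λ v → geom v * prodPow (mono (tailOnes q) ∷ []) v j) (map (a ∷_) ([] ∷ [])))) (range (deg j)))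
        ≡⟨ sum-cong (λ a → trans (+-identityʳ _) (trans (+-identityʳ _)
              (trans (*ₛ-congˡ oneₛ (mono-pow (tailOnes q) a) j) (*-one (mono (scal a (tailOnes q))) j)))) (range (deg j)) ⟩
      sum (map (λ a → mono (scal a (tailOnes q)) j) (range (deg j)))
        ≡⟨ sum-range _ (deg j) ⟩
      sumBelow (suc (deg j)) (λ a → mono (scal a (tailOnes q)) j)
        ≡⟨ sumBelow-single (suc (deg j)) _ (last j) (λ a _ ne → mono-ne (scal a (tailOnes q)) j (λ e → ne (trans (sym (last-scal-tailOnes q a)) (cong last e)))) ⟩
      guard (last j <ᵇ suc (deg j)) (mono (scal (last j) (tailOnes q)) j)
        ≡⟨ guard-t _ (T⇒≡true (<⇒<ᵇ (s≤s (last≤deg j)))) ⟩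
      mono (scal (last j) (tailOnes q)) j
    ∎

  last-subV-xp : ∀ q (j : Vec ℕ (Len q)) → last (subV j (xp q)) ≡ last j
  last-subV-xp zero (y ∷ ys) = trans (last-∷ (y ∸ 1) (subV ys zeros)) (trans (cong last (subV-zeros ys)) (sym (last-∷ y ys)))
  last-subV-xp (suc q) (x ∷ j) = trans (last-∷ (x ∸ 0) (subV j (xp q))) (trans (last-subV-xp q j) (sym (last-∷ x j)))

  xp+tailOnes : ∀ q c → addV (xp q) (scal c (tailOnes q)) ≡ gpExp q 1 c
  xp+tailOnes zero c = cong₂ _∷_ (cong suc (*-identityʳ c)) (zeros+c*ones (suc k'))
    where
    zeros+c*ones : ∀ n → addV (replicate n 0) (scal c (replicate n 1)) ≡ replicate n c
    zeros+c*ones zero = refl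
    zeros+c*ones (suc n) = cong₂ _∷_ (*-identityʳ c) (zeros+c*ones n)
  xp+tailOnes (suc q) c = cong₂ _∷_ (*-zeroʳ c) (xp+tailOnes q c)


  -- The substituted variable x_p / (1 − x_p ⋯ x_r) with p = q + 1 and r = Len q;
  -- its u-th power is Σ_c (u multichoose c) x^(gpExp q u c) (gp^≈gpCoeff).
  gp : (q : ℕ) → FPS (Len q)
  gp q = mono (xp q) *ₛ inv1m (mono (tailOnes q))

  gp≈gpCoeff : ∀ q → gp q ≈ gpCoeff q 1
  gp≈gpCoeff q j =
    begin
      gp q j
        ≡⟨ mono*ₛ (xp q) (inv1m (mono (tailOnes q))) j ⟩
      guard (leV (xp q) j) (inv1m (mono (tailOnes q)) (subV j (xp q)))
        ≡⟨ cong (guard (leV (xp q) j)) (trans (inv1m-tail q (subV j (xp q))) (cong (λ c → mono (scal c (tailOnes q)) (subV j (xp q))) (last-subV-xp q j))) ⟩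
      guard (leV (xp q) j) (mono (scal (last j) (tailOnes q)) (subV j (xp q)))
        ≡⟨ guard-mono-subV (xp q) (scal (last j) (tailOnes q)) j ⟩
      mono (addV (xp q) (scal (last j) (tailOnes q))) j
        ≡⟨ trans (cong (λ v → mono v j) (xp+tailOnes q (last j))) (mono-g (gpExp q 1 (last j)) j) ⟩
      guard (vecEq (gpExp q 1 (last j)) j) 1
        ≡⟨ cong (guard (vecEq (gpExp q 1 (last j)) j)) (sym (multichoose-1 (last j))) ⟩
      gpCoeff q 1 j
    ∎

  gpCoeff-∷ : ∀ q u a (as : Vec ℕ (Len q)) → gpCoeff (suc q) u (a ∷ as) ≡ guard (0 ≡ᵇ a) (gpCoeff q u as)
  gpCoeff-∷ q u a as rewrite last-∷ a as = sym (guard-∧ (0 ≡ᵇ a) _ _)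

  gpCoeff-base : ∀ u y (ys : Vec ℕ (suc k')) → gpCoeff 0 u (y ∷ ys) ≡ guard (u + last ys ≡ᵇ y) (guard (vecEq (replicate (suc k') (last ys)) ys) (multichoose u (last ys)))
  gpCoeff-base u y ys rewrite last-∷ y ys = sym (guard-∧ (u + last ys ≡ᵇ y) _ _)

  gpCoeff-base-rep : ∀ u z m → gpCoeff 0 u (z ∷ replicate (suc k') m) ≡ guard (u + m ≡ᵇ z) (multichoose u m)
  gpCoeff-base-rep u z m rewrite gpCoeff-base u z (replicate (suc k') m) | last-replicate k' m | vecEq-refl (replicate (suc k') m) = refl

  gpExp-0-0 : ∀ q → gpExp q 0 0 ≡ zeros
  gpExp-0-0 zero = refl
  gpExp-0-0 (suc q) = cong (0 ∷_) (gpExp-0-0 q)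

  last-zeros : ∀ n → last (replicate (suc n) 0) ≡ 0
  last-zeros n = last-replicate n 0

  one≈gpCoeff : ∀ q → (oneₛ {Len q}) ≈ gpCoeff q 0
  one≈gpCoeff q j with last j in eq
  ... | zero = trans (mono-g zeros j) (cong (λ v → guard (vecEq v j) 1) (sym (gpExp-0-0 q)))
  ... | suc c = trans (mono-ne zeros j (λ e → 0≢1+n (trans (sym (last-zeros (suc (q + k')))) (trans (cong last e) eq)))) (sym (guard-0 _))

  gpCoeff-1-base : ∀ a (as : Vec ℕ (suc k')) → gpCoeff 0 1 (a ∷ as) ≡ guard (1 ≤ᵇ a) (mono (replicate (suc k') (a ∸ 1)) as)
  gpCoeff-1-base a as rewrite gpCoeff-base 1 a as | multichoose-1 (last as) with a
  ... | zero = refl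
  ... | suc a' with last as ≟ a'
  ...   | yes refl rewrite ≡ᵇ≡true (refl {x = last as}) = sym (mono-g (replicate (suc k') (last as)) as)
  ...   | no ne rewrite ≡ᵇ≡false ne = sym (mono-ne (replicate (suc k') a') as (λ e → ne (trans (cong last (sym e)) (last-replicate k' a'))))

  isConstant : Vec ℕ (suc k') → Bool
  isConstant ys = vecEq (replicate (suc k') (last ys)) ys

  convolution : ℕ → ℕ → Vec ℕ (suc k') → ℕ
  convolution u y ys = sum (map (λ a → guard (1 ≤ᵇ a) (guard (leV (replicate (suc k') (a ∸ 1)) ys) (gpCoeff 0 u ((y ∸ a) ∷ subV ys (replicate (suc k') (a ∸ 1)))))) (range y))

  gp*gpCoeff-base : ∀ u y (ys : Vec ℕ (suc k')) → (gpCoeff 0 1 *ₛ gpCoeff 0 u) (y ∷ ys) ≡ convolution u y ys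
  gp*gpCoeff-base u y ys = trans (below-cons _ y ys) (sum-cong (λ a →
     trans (sum-cong (λ as → trans (cong (_* gpCoeff 0 u ((y ∸ a) ∷ subV ys as)) (gpCoeff-1-base a as)) (guard-* (1 ≤ᵇ a) _ _)) (below ys))
      (trans (sum-guard (1 ≤ᵇ a) _ (below ys)) (cong (guard (1 ≤ᵇ a)) (sum-mono* ys (replicate (suc k') (a ∸ 1)) (λ as → gpCoeff 0 u ((y ∸ a) ∷ subV ys as))))))
     (range y))

  convolution-constant : ∀ u y C → convolution u y (replicate (suc k') C) ≡ gpCoeff 0 (suc u) (y ∷ replicate (suc k') C)
  convolution-constant u y C =
    begin
      convolution u y (replicate (suc k') C)
        ≡⟨ trans (sum-cong (λ a → cong (guard (1 ≤ᵇ a)) (trans (cong₂ guard (leV-rep k' (a ∸ 1) C) (trans (cong (λ v → gpCoeff 0 u ((y ∸ a) ∷ v)) (subV-rep (suc k') C (a ∸ 1))) (gpCoeff-base-rep u (y ∸ a) (C ∸ (a ∸ 1))))) refl)) (range y))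
                 (sum-range (λ a → guard (1 ≤ᵇ a) (guard (a ∸ 1 ≤ᵇ C) (guard (u + (C ∸ (a ∸ 1)) ≡ᵇ y ∸ a) (multichoose u (C ∸ (a ∸ 1)))))) y) ⟩
      sumBelow (suc y) (λ a → guard (1 ≤ᵇ a) (guard (a ∸ 1 ≤ᵇ C) (guard (u + (C ∸ (a ∸ 1)) ≡ᵇ y ∸ a) (multichoose u (C ∸ (a ∸ 1))))))
        ≡⟨ by-total (y ≟ suc u + C) ⟩
      guard (suc u + C ≡ᵇ y) (multichoose (suc u) C)
        ≡⟨ sym (gpCoeff-base-rep (suc u) y C) ⟩
      gpCoeff 0 (suc u) (y ∷ replicate (suc k') C)
    ∎
    where
    term : ℕ → ℕ
    term c1 = guard (c1 ≤ᵇ C) (guard (u + (C ∸ c1) ≡ᵇ y ∸ suc c1) (multichoose u (C ∸ c1)))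
    by-total : Dec (y ≡ suc u + C) → sumBelow y term ≡ guard (suc u + C ≡ᵇ y) (multichoose (suc u) C)
    by-total (yes refl) = trans (sumBelow-trunc (suc C) (suc u + C) term (λ x le → guard-f _ (≤ᵇ≡false (λ x≤ → <-irrefl refl (≤-trans le x≤))))
                            (s≤s (m≤n+m C u)))
                     (trans (sumBelow-cong (suc C) {g = λ c1 → multichoose u (C ∸ c1)} (λ c1 lt → trans (guard-t _ (≤ᵇ≡true (≤-pred lt)))
                               (guard-t _ (≡ᵇ≡true (sym (+-∸-assoc u (≤-pred lt)))))))
                       (trans (multichoose-hockey u C) (sym (guard-t _ (≡ᵇ≡true (refl {x = suc u + C}))))))
    by-total (no ne) = trans (sumBelow-zero y term (λ c1 lt → guard-≡0 (c1 ≤ᵇ C) _ (λ e1 → guard-f _ (≡ᵇ≡false (λ e2 →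
                    ne (trans (sym (m∸n+n≡m lt)) (trans (cong (_+ suc c1) (sym e2))
                      (trans (+-suc _ c1) (cong suc (trans (+-assoc u (C ∸ c1) c1) (cong (u +_) (m∸n+n≡m (≤ᵇ≡true⇒≤ {c1} {C} e1)))))))))))))
                    (sym (guard-f _ (≡ᵇ≡false (λ e → ne (sym e)))))

  isConstant-rep : ∀ m → isConstant (replicate (suc k') m) ≡ true
  isConstant-rep m rewrite last-replicate k' m = vecEq-refl (replicate (suc k') m)

  convolution-nonconstant : ∀ u y ys → isConstant ys ≡ false → convolution u y ys ≡ 0
  convolution-nonconstant u y ys nr = sum-zero _ (λ a → guard-≡0 (1 ≤ᵇ a) _ (λ _ → guard-≡0 (leV (replicate (suc k') (a ∸ 1)) ys) _ (λ le →
      let zs = subV ys (replicate (suc k') (a ∸ 1)) in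
      trans (gpCoeff-base u (y ∸ a) zs) (guard-≡0 (u + last zs ≡ᵇ y ∸ a) _ (λ _ →
        guard-≡0 (vecEq (replicate (suc k') (last zs)) zs) _ (λ ve →
          let ye = rep-recover ys (a ∸ 1) (last zs) le (sym (vecEq-true (replicate (suc k') (last zs)) zs ve))
          in case trans (sym nr) (trans (cong isConstant ye) (isConstant-rep _)) of λ ())))))) (range y)

  gp*gpCoeff : ∀ q u j → (gpCoeff q 1 *ₛ gpCoeff q u) j ≡ gpCoeff q (suc u) j
  gp*gpCoeff zero u (y ∷ ys) with isConstant ys in eq
  ... | true = let e = vecEq-true (replicate (suc k') (last ys)) ys eq in
      trans (gp*gpCoeff-base u y ys) (trans (cong (convolution u y) (sym e)) (trans (convolution-constant u y (last ys)) (cong (λ v → gpCoeff 0 (suc u) (y ∷ v)) e)))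
  ... | false = trans (gp*gpCoeff-base u y ys) (trans (convolution-nonconstant u y ys eq)
      (sym (trans (gpCoeff-base (suc u) y ys) (trans (cong (guard (suc u + last ys ≡ᵇ y)) (guard-f _ eq)) (guard-≡0 _ 0 (λ _ → refl))))))
  gp*gpCoeff (suc q) u (x ∷ j) =
    begin
      (gpCoeff (suc q) 1 *ₛ gpCoeff (suc q) u) (x ∷ j)
        ≡⟨ below-cons _ x j ⟩
      sum (map (λ a → sum (map (λ as → gpCoeff (suc q) 1 (a ∷ as) * gpCoeff (suc q) u ((x ∸ a) ∷ subV j as)) (below j))) (range x))
        ≡⟨ sum-cong (λ a → trans (sum-cong (λ as → trans (cong₂ _*_ (gpCoeff-∷ q 1 a as) (gpCoeff-∷ q u (x ∸ a) (subV j as))) (guard-* (0 ≡ᵇ a) _ _)) (below j))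
                             (sum-guard (0 ≡ᵇ a) _ (below j))) (range x) ⟩
      sum (map (λ a → guard (0 ≡ᵇ a) (sum (map (λ as → gpCoeff q 1 as * guard (0 ≡ᵇ x ∸ a) (gpCoeff q u (subV j as))) (below j)))) (range x))
        ≡⟨ sum-range-at x 0 _ ⟩
      sum (map (λ as → gpCoeff q 1 as * guard (0 ≡ᵇ x) (gpCoeff q u (subV j as))) (below j))
        ≡⟨ trans (sum-cong (λ as → *-guard (gpCoeff q 1 as) (0 ≡ᵇ x) _) (below j)) (sum-guard (0 ≡ᵇ x) _ (below j)) ⟩
      guard (0 ≡ᵇ x) ((gpCoeff q 1 *ₛ gpCoeff q u) j)
        ≡⟨ cong (guard (0 ≡ᵇ x)) (gp*gpCoeff q u j) ⟩
      guard (0 ≡ᵇ x) (gpCoeff q (suc u) j)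
        ≡⟨ sym (gpCoeff-∷ q (suc u) x j) ⟩
      gpCoeff (suc q) (suc u) (x ∷ j)
    ∎

  gp^≈gpCoeff : ∀ q u → (gp q ^ₛ u) ≈ gpCoeff q u
  gp^≈gpCoeff q zero = one≈gpCoeff q
  gp^≈gpCoeff q (suc u) j = trans (*ₛ-congˡ (gp q ^ₛ u) (gp≈gpCoeff q) j) (trans (*ₛ-congʳ (gpCoeff q 1) (gp^≈gpCoeff q u) j) (gp*gpCoeff q u j))

module SubstVec (k' : ℕ) where

  open Substitute k'

  k : ℕ
  k = suc (suc k')

  Len∸k≡q : ∀ q → Len q ∸ k ≡ q
  Len∸k≡q q = m+n∸n≡m q k'

  unitVec≡xp : ∀ q → unitVec (Len q) q ≡ xp q
  unitVec≡xp zero = unitVec-0 (suc k')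
  unitVec≡xp (suc q) = cong (0 ∷_) (unitVec≡xp q)

  tailBlock≡tailOnes : ∀ q → tailBlock (Len q) q ≡ tailOnes q
  tailBlock≡tailOnes zero = tabulate-const _ 1
  tailBlock≡tailOnes (suc q) = cong (0 ∷_) (trans (VP.tabulate-cong (λ l → cong (λ b → if b then 1 else 0) (<ᵇ-suc q (toℕ l)))) (tailBlock≡tailOnes q))

  lookup-substVec : ∀ q (l : Fin (suc (q + k'))) → lookup (substVec k (Len q)) l ≡ (if toℕ l ≡ᵇ q then gp q else var (Len q) (toℕ l))
  lookup-substVec q l =
    trans (VP.lookup∘tabulate (λ l → if toℕ l ≡ᵇ Len q ∸ k then var (Len q) (Len q ∸ k) *ₛ inv1m (mono (tailBlock (Len q) (Len q ∸ k))) else var (Len q) (toℕ l)) l)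
      (trans (cong (λ m → if toℕ l ≡ᵇ m then var (Len q) m *ₛ inv1m (mono (tailBlock (Len q) m)) else var (Len q) (toℕ l)) (Len∸k≡q q))
        (cong₂ (λ u t → if toℕ l ≡ᵇ q then mono u *ₛ inv1m (mono t) else var (Len q) (toℕ l)) (unitVec≡xp q) (tailBlock≡tailOnes q)))

  gp-suc : ∀ q → gp (suc q) ≈ shift (gp q)
  gp-suc q (x ∷ j) = trans (gp≈gpCoeff (suc q) (x ∷ j)) (trans (gpCoeff-∷ q 1 x j) (sym (shift-cong (gp≈gpCoeff q) (x ∷ j))))

  substVec-suc : ∀ q (l : Fin (suc (suc q + k'))) → lookup (substVec k (Len (suc q))) l ≈ lookup (var (Len (suc q)) 0 ∷ Vec.map shift (substVec k (Len q))) l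
  substVec-suc q Fin.zero v = cong (λ F → F v) (lookup-substVec (suc q) Fin.zero)
  substVec-suc q (Fin.suc l) v =
    trans (cong (λ F → F v) (lookup-substVec (suc q) (Fin.suc l)))
      (trans (shift-if (toℕ l ≡ᵇ q) v)
        (sym (trans (cong (λ F → F v) (VP.lookup-map l shift (substVec k (Len q)))) (cong (λ F → shift F v) (lookup-substVec q l)))))
    where
    shift-if : ∀ b → (if b then gp (suc q) else var (Len (suc q)) (suc (toℕ l))) ≈ shift (if b then gp q else var (Len q) (toℕ l))
    shift-if true = gp-suc q
    shift-if false = var-shift (Len q) (toℕ l)

  substVec-base : ∀ (l : Fin (suc k')) → lookup (substVec k (Len 0)) l ≈ lookup (gp 0 ∷ Vec.map shift (tabulate (λ l → var (suc k') (toℕ l)))) l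
  substVec-base Fin.zero v = cong (λ F → F v) (lookup-substVec 0 Fin.zero)
  substVec-base (Fin.suc l) v =
    trans (cong (λ F → F v) (lookup-substVec 0 (Fin.suc l)))
      (trans (var-shift (suc k') (toℕ l) v)
        (sym (trans (cong (λ F → F v) (VP.lookup-map l shift (tabulate (λ l → var (suc k') (toℕ l)))))
          (cong (λ F → shift F v) (VP.lookup∘tabulate (λ l → var (suc k') (toℕ l)) l)))))

  raiseVec : (q : ℕ) → Vec ℕ (suc (q + k')) → ℕ → Vec ℕ (Len q)
  raiseVec zero (y ∷ ys) c = (y + c) ∷ liftTail ys c
  raiseVec (suc q) (x ∷ a) c = x ∷ raiseVec q a c

  atP : (q : ℕ) → Vec ℕ (suc (q + k')) → ℕ
  atP zero (y ∷ ys) = y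
  atP (suc q) (x ∷ a) = atP q a

  prodPow-substVec : ∀ q (a : Vec ℕ (suc (q + k'))) i → prodPow (substVec k (Len q)) a i ≡ guard (vecEq (raiseVec q a (last i)) i) (multichoose (atP q a) (last i))
  prodPow-substVec zero (y ∷ ys) (z ∷ zs) =
    begin
      prodPow (substVec k (Len 0)) (y ∷ ys) (z ∷ zs)
        ≡⟨ prodPow-cong (substVec k (Len 0)) (gp 0 ∷ Vec.map shift (tabulate (λ l → var (suc k') (toℕ l)))) substVec-base (y ∷ ys) (z ∷ zs) ⟩
      ((gp 0 ^ₛ y) *ₛ prodPow (Vec.map shift (tabulate (λ l → var (suc k') (toℕ l)))) ys) (z ∷ zs)
        ≡⟨ trans (*ₛ-congˡ (prodPow (Vec.map shift (tabulate (λ l → var (suc k') (toℕ l)))) ys) (gp^≈gpCoeff 0 y) (z ∷ zs))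
             (*ₛ-congʳ (gpCoeff 0 y) (λ v → trans (prodPow-shift (tabulate (λ l → var (suc k') (toℕ l))) ys v)
                 (trans (shift-cong (prodPow-vars k' ys) v) (shift-snoc0 v))) (z ∷ zs)) ⟩
      (gpCoeff 0 y *ₛ mono (0 ∷ snoc0 ys)) (z ∷ zs)
        ≡⟨ *ₛmono (0 ∷ snoc0 ys) (gpCoeff 0 y) (z ∷ zs) ⟩
      guard (leV (snoc0 ys) zs) (gpCoeff 0 y (z ∷ subV zs (snoc0 ys)))
        ≡⟨ cong (guard (leV (snoc0 ys) zs)) (trans (gpCoeff-base y z (subV zs (snoc0 ys))) (cong (λ c → guard (y + c ≡ᵇ z) (guard (vecEq (replicate (suc k') c) (subV zs (snoc0 ys))) (multichoose y c))) (last-subV-snoc0 ys zs))) ⟩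
      guard (leV (snoc0 ys) zs) (guard (y + last zs ≡ᵇ z) (guard (vecEq (replicate (suc k') (last zs)) (subV zs (snoc0 ys))) (multichoose y (last zs))))
        ≡⟨ trans (guard-comm (leV (snoc0 ys) zs) (y + last zs ≡ᵇ z) (guard (vecEq (replicate (suc k') (last zs)) (subV zs (snoc0 ys))) (multichoose y (last zs)))) (cong (guard (y + last zs ≡ᵇ z)) (trans (guard-∧ (leV (snoc0 ys) zs) _ _) (cong (λ b → guard b (multichoose y (last zs))) (liftTail-match ys zs (last zs))))) ⟩
      guard (y + last zs ≡ᵇ z) (guard (vecEq (liftTail ys (last zs)) zs) (multichoose y (last zs)))
        ≡⟨ trans (guard-∧ (y + last zs ≡ᵇ z) _ _) (cong (λ c → guard (vecEq (raiseVec 0 (y ∷ ys) c) (z ∷ zs)) (multichoose y c)) (sym (last-∷ z zs))) ⟩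
      guard (vecEq (raiseVec 0 (y ∷ ys) (last (z ∷ zs))) (z ∷ zs)) (multichoose (atP 0 (y ∷ ys)) (last (z ∷ zs)))
    ∎
    where
    shift-snoc0 : shift (mono (snoc0 ys)) ≈ mono (0 ∷ snoc0 ys)
    shift-snoc0 (x ∷ j) = sym (mono-cons 0 (snoc0 ys) x j)
  prodPow-substVec (suc q) (x0 ∷ a) (x ∷ j) =
    begin
      prodPow (substVec k (Len (suc q))) (x0 ∷ a) (x ∷ j)
        ≡⟨ prodPow-cong (substVec k (Len (suc q))) (var (Len (suc q)) 0 ∷ Vec.map shift (substVec k (Len q))) (substVec-suc q) (x0 ∷ a) (x ∷ j) ⟩
      ((var (Len (suc q)) 0 ^ₛ x0) *ₛ prodPow (Vec.map shift (substVec k (Len q))) a) (x ∷ j)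
        ≡⟨ trans (*ₛ-congˡ (prodPow (Vec.map shift (substVec k (Len q))) a) (var0^ (Len q) x0) (x ∷ j))
             (*ₛ-congʳ (mono (x0 ∷ zeros)) (prodPow-shift (substVec k (Len q)) a) (x ∷ j)) ⟩
      (mono (x0 ∷ zeros) *ₛ shift (prodPow (substVec k (Len q)) a)) (x ∷ j)
        ≡⟨ var0^*shift x0 (prodPow (substVec k (Len q)) a) x j ⟩
      guard (x0 ≡ᵇ x) (prodPow (substVec k (Len q)) a j)
        ≡⟨ cong (guard (x0 ≡ᵇ x)) (prodPow-substVec q a j) ⟩
      guard (x0 ≡ᵇ x) (guard (vecEq (raiseVec q a (last j)) j) (multichoose (atP q a) (last j)))
        ≡⟨ trans (guard-∧ (x0 ≡ᵇ x) _ _) (cong (λ c → guard (vecEq (raiseVec (suc q) (x0 ∷ a) c) (x ∷ j)) (multichoose (atP q a) c)) (sym (last-∷ x j))) ⟩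
      guard (vecEq (raiseVec (suc q) (x0 ∷ a) (last (x ∷ j))) (x ∷ j)) (multichoose (atP (suc q) (x0 ∷ a)) (last (x ∷ j)))
    ∎

-- The recursion

levelFun-last : ∀ {n} (v : Vec ℕ (suc n)) → levelFun v (suc n) ≡ last v
levelFun-last (x ∷ []) = refl
levelFun-last (x ∷ y ∷ ys) = levelFun-last (y ∷ ys)

levelFun-liftTail : ∀ {n} (ys : Vec ℕ n) c j → levelFun (liftTail ys c) (suc j) ≡ (if j ≡ᵇ n then c else (if suc j ≤ᵇ n then levelFun ys (suc j) + c else levelFun ys (suc j)))
levelFun-liftTail [] c zero = refl
levelFun-liftTail [] c (suc j) = refl
levelFun-liftTail (x ∷ ys) c zero = refl
levelFun-liftTail (x ∷ ys) c (suc j) = levelFun-liftTail ys c j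

lowerTail : ∀ {n} → ℕ → Vec ℕ (suc n) → Vec ℕ n
lowerTail c (z ∷ []) = []
lowerTail c (z ∷ z' ∷ zs) = (z ∸ c) ∷ lowerTail c (z' ∷ zs)

liftTail-lowerTail : ∀ {n} (ys : Vec ℕ (suc n)) c → c ≡ last ys → (∀ m → 1 ≤ m → m ≤ n → c ≤ levelFun ys m) → liftTail (lowerTail c ys) c ≡ ys
liftTail-lowerTail (z ∷ []) c e h = cong (_∷ []) e
liftTail-lowerTail (z ∷ z' ∷ zs) c e h = cong₂ _∷_ (m∸n+n≡m (h 1 ≤-refl (s≤s z≤n))) (liftTail-lowerTail (z' ∷ zs) c e (λ m a b → subst (c ≤_) (levelFun-∷ z (z' ∷ zs) m a) (h (suc m) (≤-trans a (n≤1+n m)) (s≤s b))))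

liftTail-injective : ∀ {n} (a b : Vec ℕ n) c → liftTail a c ≡ liftTail b c → a ≡ b
liftTail-injective [] [] c e = refl
liftTail-injective (x ∷ a) (y ∷ b) c e = cong₂ _∷_ (+-cancelʳ-≡ c x y (VP.∷-injectiveˡ e)) (liftTail-injective a b c (VP.∷-injectiveʳ e))

deg-liftTail : ∀ {n} (ys : Vec ℕ n) c → deg (liftTail ys c) ≡ deg ys + suc n * c
deg-liftTail [] c = refl
deg-liftTail {suc n} (x ∷ ys) c rewrite deg-liftTail ys c =
  solve 4 (λ x d c nc → (x :+ c) :+ (d :+ (c :+ nc)) := (x :+ d) :+ (c :+ (c :+ nc))) refl x (deg ys) c (n * c)

AllBounded-lowerTail : ∀ {n} c (ys : Vec ℕ (suc n)) d → deg ys ≤ d → AllBounded d (lowerTail c ys)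
AllBounded-lowerTail c (z ∷ []) d le = tt
AllBounded-lowerTail c (z ∷ z' ∷ zs) d le = ≤-trans (m∸n≤m z c) (≤-trans (m≤m+n z _) le) , AllBounded-lowerTail c (z' ∷ zs) d (≤-trans (m≤n+m _ z) le)

atLeastOn? : ∀ (f : ℕ → ℕ) c lo hi → (∀ l → lo ≤ l → l ≤ hi → c ≤ f l) ⊎ Σ ℕ (λ l → (lo ≤ l) × (l ≤ hi) × (f l < c))
atLeastOn? f c lo zero with lo ≟ 0
... | no ne = inj₁ (λ l a b → ⊥-elim (ne (n≤0⇒n≡0 (≤-trans a b))))
... | yes refl with c ≤? f 0
...   | yes h = inj₁ (λ l a b → subst (λ x → c ≤ f x) (sym (n≤0⇒n≡0 b)) h)
...   | no nh = inj₂ (0 , z≤n , z≤n , ≰⇒> nh)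
atLeastOn? f c lo (suc hi) with atLeastOn? f c lo hi
... | inj₂ (l , a , b , x) = inj₂ (l , a , ≤-trans b (n≤1+n hi) , x)
... | inj₁ all with lo ≤? suc hi
...   | no nlo = inj₁ (λ l a b → all l a (≤-pred-≢ b (λ e → nlo (subst (lo ≤_) e a))))
...   | yes lo≤ with c ≤? f (suc hi)
...     | yes h = inj₁ (λ l a b → at-or-below l a b)
  where
  at-or-below : ∀ l → lo ≤ l → l ≤ suc hi → c ≤ f l
  at-or-below l a b with l ≟ suc hi
  ... | yes refl = h
  ... | no ne = all l a (≤-pred-≢ b ne)
...     | no nh = inj₂ (suc hi , lo≤ , ≤-refl , ≰⇒> nh)

module Recursion (k' : ℕ) where

  open Substitute k' using (Len)

  open SubstVec k' using (raiseVec; atP; prodPow-substVec)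

  k : ℕ
  k = suc (suc k')

  levelFun-raiseVec : ∀ q a c j → levelFun (raiseVec q a c) j ≡ RemoveTop.raise k' q (levelFun a) c j
  levelFun-raiseVec zero (y ∷ ys) c zero = refl
  levelFun-raiseVec zero (y ∷ ys) c (suc zero) = refl
  levelFun-raiseVec zero (y ∷ ys) c (suc (suc j)) = levelFun-liftTail ys c j
  levelFun-raiseVec (suc q) (x ∷ a) c zero = refl
  levelFun-raiseVec (suc q) (x ∷ a) c (suc zero) = refl
  levelFun-raiseVec (suc q) (x ∷ a) c (suc (suc j)) = levelFun-raiseVec q a c (suc j)

  deg-raiseVec : ∀ q a c → deg (raiseVec q a c) ≡ deg a + k * c
  deg-raiseVec zero (y ∷ ys) c rewrite deg-liftTail ys c =
    solve 4 (λ y c d m → (y :+ c) :+ (d :+ m) := (y :+ d) :+ (c :+ m)) refl y c (deg ys) (suc k' * c)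
  deg-raiseVec (suc q) (x ∷ a) c rewrite deg-raiseVec q a c = sym (+-assoc x (deg a) (k * c))

  levelFun-atP : ∀ q a → levelFun a (suc q) ≡ atP q a
  levelFun-atP zero (y ∷ ys) = refl
  levelFun-atP (suc q) (x ∷ a) = levelFun-atP q a

  raiseVec-injective : ∀ q a b c → raiseVec q a c ≡ raiseVec q b c → a ≡ b
  raiseVec-injective zero (y ∷ ys) (y' ∷ ys') c e = cong₂ _∷_ (+-cancelʳ-≡ c y y' (VP.∷-injectiveˡ e)) (liftTail-injective ys ys' c (VP.∷-injectiveʳ e))
  raiseVec-injective (suc q) (x ∷ a) (x' ∷ b) c e = cong₂ _∷_ (VP.∷-injectiveˡ e) (raiseVec-injective q a b c (VP.∷-injectiveʳ e))

  lowerVec : (q : ℕ) → ℕ → Vec ℕ (Len q) → Vec ℕ (suc (q + k'))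
  lowerVec zero c (y ∷ ys) = (y ∸ c) ∷ lowerTail c ys
  lowerVec (suc q) c (x ∷ j) = x ∷ lowerVec q c j

  raiseVec-lowerVec : ∀ q (i : Vec ℕ (Len q)) c → c ≡ last i → (∀ l → suc q ≤ l → l ≤ suc (q + k') → c ≤ levelFun i l) → raiseVec q (lowerVec q c i) c ≡ i
  raiseVec-lowerVec zero (y ∷ ys) c e h =
    cong₂ _∷_ (m∸n+n≡m (h 1 ≤-refl (s≤s z≤n)))
      (liftTail-lowerTail ys c (trans e (last-∷ y ys)) (λ m a b → subst (c ≤_) (levelFun-∷ y ys m a) (h (suc m) (s≤s z≤n) (s≤s b))))
  raiseVec-lowerVec (suc q) (x ∷ j) c e h =
    cong (x ∷_) (raiseVec-lowerVec q j c (trans e (last-∷ x j)) (λ l a b → subst (c ≤_) (levelFun-∷ x j l (≤-trans (s≤s z≤n) a)) (h (suc l) (s≤s a) (s≤s b))))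

  AllBounded-lowerVec : ∀ q c (i : Vec ℕ (Len q)) d → deg i ≤ d → AllBounded d (lowerVec q c i)
  AllBounded-lowerVec zero c (y ∷ ys) d le = ≤-trans (m∸n≤m y c) (≤-trans (m≤m+n y _) le) , AllBounded-lowerTail c ys d (≤-trans (m≤n+m _ y) le)
  AllBounded-lowerVec (suc q) c (x ∷ j) d le = ≤-trans (m≤m+n x _) le , AllBounded-lowerVec q c j d (≤-trans (m≤n+m _ x) le)

  T≡walks : ∀ r0 (i : Vec ℕ (suc r0)) → T k (suc r0) i ≡ walks k (suc r0) (deg i) 0 (levelFun i)
  T≡walks r0 (zero ∷ is) with deg is
  ... | zero = refl
  ... | suc N = refl
  T≡walks r0 (suc a ∷ is) = Counting.t≡walks k' (suc a ∷ is)

  module _ (q : ℕ) where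
    open RemoveTop k' q using (p; r; raise-mid; walks-raise; violated⇒walks≡0; δ-low; ε-≢top)

    T-raiseVec : ∀ a c → T k (Len q) (raiseVec q a c) ≡ multichoose (atP q a) c * T k (suc (q + k')) a
    T-raiseVec a c =
      begin
        T k (Len q) (raiseVec q a c)
          ≡⟨ T≡walks (suc (q + k')) (raiseVec q a c) ⟩
        walks k (Len q) (deg (raiseVec q a c)) 0 (levelFun (raiseVec q a c))
          ≡⟨ cong (λ N → walks k (Len q) N 0 (levelFun (raiseVec q a c))) (deg-raiseVec q a c) ⟩
        walks k (Len q) (deg a + k * c) 0 (levelFun (raiseVec q a c))
          ≡⟨ walks-cong k (Len q) (deg a + k * c) 0 (levelFun-raiseVec q a c) ⟩
        walks k (Len q) (deg a + k * c) 0 (RemoveTop.raise k' q (levelFun a) c)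
          ≡⟨ walks-raise (deg a) c 0 (levelFun a) z≤n (total-levelFun a) ⟩
        multichoose (levelFun a p) c * walks k (suc (q + k')) (deg a) 0 (levelFun a)
          ≡⟨ cong₂ (λ x y → multichoose x c * y) (levelFun-atP q a) (sym (T≡walks (q + k') a)) ⟩
        multichoose (atP q a) c * T k (suc (q + k')) a
      ∎

    T-starved≡0 : ∀ i l → suc q ≤ l → l ≤ suc (q + k') → levelFun i l < last i → T k (Len q) i ≡ 0
    T-starved≡0 i l pl lr lt =
      trans (T≡walks (suc (q + k')) i)
        (violated⇒walks≡0 (deg i) 0 (levelFun i) z≤n (l , pl , lr ,
          subst-< (trans (cong (levelFun i l +_) (δ-low 0 l z≤n)) (+-identityʳ _))
                  (trans (cong (levelFun i r +_) (ε-≢top 0 l (λ ()))) (trans (+-identityʳ _) (levelFun-last i))) lt))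

    raiseVec-≤ : ∀ a c l → suc q ≤ l → l ≤ suc (q + k') → c ≤ levelFun (raiseVec q a c) l
    raiseVec-≤ a c l pl lr =
      subst (c ≤_) (sym (trans (levelFun-raiseVec q a c l) (raise-mid (levelFun a) c l pl lr))) (m≤n+m c (levelFun a l))

    compose-substVec : ∀ i → compose (T k (suc (q + k'))) (substVec k (Len q)) i
      ≡ sum (map (λ a → T k (suc (q + k')) a * guard (vecEq (raiseVec q a (last i)) i) (multichoose (atP q a) (last i)))
                 (box (suc (q + k')) (deg i)))
    compose-substVec i = sum-cong (λ a → cong (T k (suc (q + k')) a *_) (prodPow-substVec q a i)) (box (suc (q + k')) (deg i))

    T-recursion : ∀ (i : Vec ℕ (Len q)) → T k (Len q) i ≡ compose (T k (suc (q + k'))) (substVec k (Len q)) i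
    T-recursion i with atLeastOn? (levelFun i) (last i) (suc q) (suc (q + k'))
    ... | inj₁ balanced =
      begin
        T k (Len q) i
          ≡⟨ cong (T k (Len q)) (sym i≡raise) ⟩
        T k (Len q) (raiseVec q a₀ c)
          ≡⟨ T-raiseVec a₀ c ⟩
        multichoose (atP q a₀) c * T k (suc (q + k')) a₀
          ≡⟨ *-comm (multichoose (atP q a₀) c) _ ⟩
        T k (suc (q + k')) a₀ * multichoose (atP q a₀) c
          ≡⟨ cong (T k (suc (q + k')) a₀ *_) (sym (guard-t _ (subst (λ v → vecEq v i ≡ true) (sym i≡raise) (vecEq-refl i)))) ⟩
        term a₀
          ≡⟨ sym (sum-box-single (suc (q + k')) (deg i) a₀ term (AllBounded-lowerVec q c i (deg i) ≤-refl) term-≢a₀) ⟩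
        sum (map term (box (suc (q + k')) (deg i)))
          ≡⟨ sym (compose-substVec i) ⟩
        compose (T k (suc (q + k'))) (substVec k (Len q)) i
      ∎
      where
      c : ℕ
      c = last i
      a₀ : Vec ℕ (suc (q + k'))
      a₀ = lowerVec q c i
      i≡raise : raiseVec q a₀ c ≡ i
      i≡raise = raiseVec-lowerVec q i c refl balanced
      term : Vec ℕ (suc (q + k')) → ℕ
      term a = T k (suc (q + k')) a * guard (vecEq (raiseVec q a c) i) (multichoose (atP q a) c)
      term-≢a₀ : ∀ a → ¬ a ≡ a₀ → term a ≡ 0
      term-≢a₀ a ne = trans (cong (T k (suc (q + k')) a *_)
                               (guard-f _ (vecEq-false (raiseVec q a c) i (λ e → ne (raiseVec-injective q a a₀ c (trans e (sym i≡raise)))))))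
                            (*-zeroʳ (T k (suc (q + k')) a))
    ... | inj₂ (l , pl , lr , starved) =
      trans (T-starved≡0 i l pl lr starved)
        (sym (trans (compose-substVec i) (sum-zero _ term≡0 (box (suc (q + k')) (deg i)))))
      where
      c : ℕ
      c = last i
      term≡0 : ∀ a → T k (suc (q + k')) a * guard (vecEq (raiseVec q a c) i) (multichoose (atP q a) c) ≡ 0
      term≡0 a with vecEq (raiseVec q a c) i in eq
      ... | false = *-zeroʳ (T k (suc (q + k')) a)
      ... | true = ⊥-elim (<⇒≱ starved (subst (λ v → c ≤ levelFun v l) (vecEq-true (raiseVec q a c) i eq) (raiseVec-≤ a c l pl lr)))

module Small (k' : ℕ) where

  k : ℕ
  k = suc (suc k')

  walks-from≥2≡0 : ∀ R → R < k → ∀ N z g → 2 ≤ z → z ≤ R → walks k R N z g ≡ 0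
  walks-from≥2≡0 R Rk zero z g z2 zR = guard-f 1 (cong (_∧ (total R g ≡ᵇ 0)) (≡ᵇ≡false (λ e → <-irrefl (sym e) z2)))
  walks-from≥2≡0 R Rk (suc N) z g z2 zR = cong₂ _+_
    (guard-≡0 ((suc z ≤ᵇ R) ∧ (1 ≤ᵇ g (suc z))) _ (λ e → walks-from≥2≡0 R Rk N (suc z) (decAt g (suc z)) (≤-trans z2 (n≤1+n z)) (≤ᵇ≡true⇒≤ (∧-elimˡ e))))
    (guard-f _ (cong (_∧ (1 ≤ᵇ g (z ∸ suc k'))) (≤ᵇ≡false (λ x → <-irrefl refl (≤-trans Rk (≤-trans x zR))))))

  T-small : ∀ r0 → suc r0 ≤ suc k' → T k (suc r0) ≈ var (suc r0) 0
  T-small r0 le (zero ∷ is) = sym (trans (cong (λ v → mono v (zero ∷ is)) (unitVec-0 r0)) (mono-cons 1 zeros 0 is))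
  T-small r0 le (suc a ∷ is) =
    trans (Counting.t≡walks k' (suc a ∷ is))
      (trans (+-identityʳ _)
        (trans (walks-from-1 a (deg is) refl refl)
          (sym (trans (cong (λ v → mono v (suc a ∷ is)) (unitVec-0 r0)) (trans (mono-cons 1 zeros (suc a) is) (cong (guard (1 ≡ᵇ suc a)) (trans (mono-g zeros is) (cong (λ b → guard b 1) (vecEq-zeros is)))))))))
    where
    f : ℕ → ℕ
    f = levelFun (suc a ∷ is)
    walks-climb≡0 : ∀ M g → walks k (suc r0) (suc M) 1 g ≡ 0
    walks-climb≡0 M g = trans (cong (_+ 0) (guard-≡0 ((2 ≤ᵇ suc r0) ∧ (1 ≤ᵇ g 2)) _ (λ e → walks-from≥2≡0 (suc r0) (s≤s le) M 2 (decAt g 2) ≤-refl (≤ᵇ≡true⇒≤ (∧-elimˡ e))))) refl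
    walks-from-1 : ∀ a' d → a' ≡ a → d ≡ deg is → walks k (suc r0) (a' + d) 1 (decAt f 1) ≡ guard (1 ≡ᵇ suc a') (guard (d ≡ᵇ 0) 1)
    walks-from-1 zero zero refl e2 =
      let t0 : total (suc r0) (decAt f 1) ≡ 0
          t0 = suc-injective (trans (suc-total-decAt (suc r0) f 1 ≤-refl (s≤s z≤n) (s≤s z≤n)) (trans (total-levelFun (suc a ∷ is)) (cong suc (sym e2))))
      in cong (λ x → guard (true ∧ (x ≡ᵇ 0)) 1) t0
    walks-from-1 zero (suc d) refl e2 = walks-climb≡0 d (decAt f 1)
    walks-from-1 (suc a') d refl e2 = walks-climb≡0 (a' + d) (decAt f 1)

lemma3p7 : (k : ℕ) → 2 ≤ k →
    ((r : ℕ) → 1 ≤ r → r ≤ k ∸ 1 → T k r ≈ var r 0)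
    × ((r : ℕ) → k ≤ r → T k r ≈ compose (T k (r ∸ 1)) (substVec k r))
lemma3p7 (suc (suc k')) (s≤s (s≤s z≤n)) = below-k , from-k
  where
  k : ℕ
  k = suc (suc k')

  below-k : (r : ℕ) → 1 ≤ r → r ≤ suc k' → T k r ≈ var r 0
  below-k (suc r₀) _ r<k = Small.T-small k' r₀ r<k

  from-k : (r : ℕ) → k ≤ r → T k r ≈ compose (T k (r ∸ 1)) (substVec k r)
  from-k r k≤r = subst (λ r → T k r ≈ compose (T k (r ∸ 1)) (substVec k r)) (sym r≡Len)
                   (Recursion.T-recursion k' (r ∸ k))
    where
    r≡Len : r ≡ Substitute.Len k' (r ∸ k)
    r≡Len = trans (sym (m∸n+n≡m k≤r)) (solve 2 (λ q k' → q :+ (con 2 :+ k') := con 2 :+ (q :+ k')) refl (r ∸ k) k')
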